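{- Each of the five families of subsets $(sS_n)_{n\ge1}$, $(cS_n)_{n\ge1}$, $(gS_n)_{n\ge1}$, $(bS_n)_{n\ge1}$, $(tS_n)_{n\ge1}$ of the symmetric groups $\Sigma_n$ has exponential growth.
   Context: Permutations act on $[n]=\{1,\dots,n\}$; products are composed right to left, $(\alpha\beta)(x)=\alpha(\beta(x))$. A segment is a set $\{i,i+1,\dots,j\}\subseteq[n]$. (s) $\pi\in\Sigma_n$ is segment-simple ($\pi\in sS_n$) if there is no segment $I\subseteq[n]$ with $1<|I|<n$ such that $\pi(I)$ is also a segment. (c) $\pi$ is cycle-simple ($\pi\in cS_n$) if its disjoint cycle decomposition contains at most one cycle of length $\ge2$. (g) $\pi$ is group-simple ($\pi\in gS_n$) if the cyclic subgroup generated by $\pi$ is a simple group (the identity counts as group-simple). (b) Let $\tau_i=(i,i+1)$ and $D(k,j)=\tau_k\tau_{k-1}\cdots\tau_j$ for $1\le j\le k\le n-1$. Every $\pi\ne \mathrm{Id}$ has a unique expression $\pi=D(k_1,j_1)D(k_2,j_2)\cdots D(k_s,j_s)$ with $1\le k_1<k_2<\dots<k_s\le n-1$, $j_a\le k_a$, whose number of letters equals the Coxeter length of $\pi$ (this is the length-lexicographically smallest reduced word for the order $\tau_1<\dots<\tau_{n-1}$). $\pi$ is braid-simple ($\pi\in bS_n$) if $\pi=\mathrm{Id}$ or each $\tau_i$ occurs at most once in this word. (t) Write each cycle of $\pi$ (including fixed points) starting with its largest element, order the cycles by increasing largest element, and erase parentheses to obtain a word $w$ in the letters $[n]$. Define a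 binary tree $T(w)$ recursively: $T(\emptyset)=\emptyset$; otherwise, writing $w=usv$ with $s$ the smallest letter, $T(w)$ has root $s$, left subtree $T(u)$ and right subtree $T(v)$. Set $T(\pi)=T(w)$. $\pi$ is tree-simple ($\pi\in tS_n$) if every vertex of $T(\pi)$ has degree $1$ or $2$ as a graph vertex (for $n=1$ the one-vertex tree counts as tree-simple). A family $(A_n)$ with $A_n\subseteq\Sigma_n$ has exponential growth if there are constants $a>0$, $b>1$ with $|A_n|\ge a\,b^n$ for all sufficiently large $n$. -}

module Defs where

open import Level using (Level; _⊔_) renaming (suc to lsuc)
open import Data.Nat as ℕ using (ℕ; zero; suc; _+_; _∸_; _≤_; _<_; _⊓_; _≤?_)
open import Data.Fin as Fin using (Fin; toℕ)
open import Data.Fin.Permutation using (Permutation′; _⟨$⟩ʳ_; _≈_; id; flip; _∘ₚ_)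
open import Data.List using (List; []; _∷_; length; map; upTo; allFin; concat; takeWhile; break; foldr; concatMap)
open import Data.List.Relation.Unary.All using (All)
open import Data.List.Relation.Unary.AllPairs using (AllPairs)
open import Data.List.Relation.Unary.Unique.Propositional using (Unique)
open import Data.Product using (Σ; ∃; _×_; _,_; proj₁; proj₂)
open import Data.Sum using (_⊎_)
open import Data.Bool using (Bool; true; false; if_then_else_; _∧_)
open import Data.Unit using (⊤)
open import Relation.Nullary using (¬_; does; ¬?)
open import Relation.Binary.PropositionalEquality using (_≡_; _≢_)
import Data.Integer
import Data.Rational as ℚ
open ℚ using (ℚ)

-- Generalities.  Σ_n is  Permutation′ n  (bijections of Fin n; the point
-- x : Fin n stands for the element  toℕ x + 1  of [n]).  Two permutations
-- are equal as group elements iff they are pointwise equal ( _≈_ ).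

iter : ∀ {n} → (Fin n → Fin n) → ℕ → Fin n → Fin n
iter f zero    x = x
iter f (suc k) x = f (iter f k x)

fun : ∀ {n} → Permutation′ n → Fin n → Fin n
fun π x = π ⟨$⟩ʳ x

-- (s) segment-simple.  A segment {i,…,j} (0-based, i ≤ j < n) has
-- membership  i ≤ toℕ x ≤ j  and cardinality  j + 1 ∸ i.

InSeg : ∀ {n} → ℕ → ℕ → Fin n → Set
InSeg i j x = i ≤ toℕ x × toℕ x ≤ j

ImageIsSegment : ∀ {n} → Permutation′ n → ℕ → ℕ → Set
ImageIsSegment {n} π i j =
  Σ ℕ λ k → Σ ℕ λ l → l < n × k ≤ l ×
    (∀ (y : Fin n) → (InSeg k l y → Σ (Fin n) λ x → InSeg i j x × fun π x ≡ y)
                   × ((Σ (Fin n) λ x → InSeg i j x × fun π x ≡ y) → InSeg k l y))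

SegSimple : ∀ {n} → Permutation′ n → Set
SegSimple {n} π =
  ¬ (Σ ℕ λ i → Σ ℕ λ j → i ≤ j × j < n × 1 < j + 1 ∸ i × j + 1 ∸ i < n
        × ImageIsSegment π i j)

-- (c) cycle-simple: all points lying in cycles of length ≥ 2 (the
-- non-fixed points) lie in one and the same cycle.

CycleSimple : ∀ {n} → Permutation′ n → Set
CycleSimple {n} π =
  ∀ (x y : Fin n) → fun π x ≢ x → fun π y ≢ y → Σ ℕ λ k → iter (fun π) k x ≡ y

-- (g) group-simple: the cyclic subgroup ⟨π⟩ is a simple group (the
-- trivial group counted as simple): it has no normal subgroup that is
-- both non-trivial and proper.

pow : ∀ {n} → Permutation′ n → ℕ → Permutation′ n
pow π zero    = id
pow π (suc k) = π ∘ₚ pow π k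

-- membership in the cyclic subgroup generated by π (finite group, so
-- non-negative powers exhaust it)
InCyc : ∀ {n} → Permutation′ n → Permutation′ n → Set
InCyc π σ = Σ ℕ λ k → σ ≈ pow π k

record IsNormalSubgroupOfCyc {n} (π : Permutation′ n) (H : Permutation′ n → Set) : Set where
  field
    respects : ∀ σ τ → σ ≈ τ → H σ → H τ
    inCyc    : ∀ σ → H σ → InCyc π σ
    hasId    : H id
    closed   : ∀ σ τ → H σ → H τ → H (σ ∘ₚ τ)
    inverses : ∀ σ → H σ → H (flip σ)
    normal   : ∀ g h → InCyc π g → H h → H (flip g ∘ₚ (h ∘ₚ g))

GroupSimple : ∀ {n} → Permutation′ n → Set₁
GroupSimple {n} π =
  ∀ (H : Permutation′ n → Set) → IsNormalSubgroupOfCyc π H →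
    ¬ ((Σ (Permutation′ n) λ h → H h × ¬ (h ≈ id))
       × (Σ (Permutation′ n) λ g → InCyc π g × ¬ H g))

-- (b) braid-simple.  Letters are naturals i (1 ≤ i ≤ n-1) standing for
-- τ_i = (i, i+1); on Fin n (0-based) τ_i swaps positions i-1 and i.

-- sw i swaps the 0-based positions i and i+1 (identity if i+1 ≥ n)
sw : ∀ {n} → ℕ → Fin n → Fin n
sw {suc (suc n)} zero Fin.zero             = Fin.suc Fin.zero
sw {suc (suc n)} zero (Fin.suc Fin.zero)   = Fin.zero
sw {suc (suc n)} zero (Fin.suc (Fin.suc x)) = Fin.suc (Fin.suc x)
sw {suc zero}    zero Fin.zero             = Fin.zero
sw (suc i) Fin.zero    = Fin.zero
sw (suc i) (Fin.suc x) = Fin.suc (sw i x)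

τ : ∀ {n} → ℕ → Fin n → Fin n
τ i = sw (i ∸ 1)

evalWord : ∀ {n} → List ℕ → Fin n → Fin n
evalWord []      x = x
evalWord (i ∷ w) x = τ i (evalWord w x)

D : ℕ → ℕ → List ℕ
D k j = map (λ t → k ∸ t) (upTo (suc (k ∸ j)))

blocksWord : List (ℕ × ℕ) → List ℕ
blocksWord bs = concatMap (λ b → D (proj₁ b) (proj₂ b)) bs

Letters : ℕ → List ℕ → Set
Letters n w = All (λ i → 1 ≤ i × i ≤ n ∸ 1) w

Reduced : ∀ {n} → Permutation′ n → List ℕ → Set
Reduced {n} π w =
  ¬ (Σ (List ℕ) λ v → Letters n v × length v < length w × (∀ x → evalWord v x ≡ fun π x))

BlocksShape : ℕ → List (ℕ × ℕ) → Set
BlocksShape n bs =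
  All (λ b → 1 ≤ proj₂ b × proj₂ b ≤ proj₁ b × proj₁ b ≤ n ∸ 1) bs
  × AllPairs (λ b c → proj₁ b < proj₁ c) bs

IsNormalForm : ∀ {n} → Permutation′ n → List (ℕ × ℕ) → Set
IsNormalForm {n} π bs =
  BlocksShape n bs × (∀ x → evalWord (blocksWord bs) x ≡ fun π x)
  × Reduced π (blocksWord bs)

BraidSimple : ∀ {n} → Permutation′ n → Set
BraidSimple π =
  π ≈ id ⊎ (Σ (List (ℕ × ℕ)) λ bs → IsNormalForm π bs × Unique (blocksWord bs))

laterIterates : ∀ {n} → Permutation′ n → Fin n → List (Fin n)
laterIterates {n} π m = map (λ k → iter (fun π) (suc k) m) (upTo (n ∸ 1))

cycleFrom : ∀ {n} → Permutation′ n → Fin n → List (Fin n)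
cycleFrom π m = m ∷ takeWhile (λ y → ¬? (y Fin.≟ m)) (laterIterates π m)

isCycleMax : ∀ {n} → Permutation′ n → Fin n → Bool
isCycleMax {n} π m =
  foldr (λ k acc → does (toℕ (iter (fun π) k m) ≤? toℕ m) ∧ acc) true (upTo n)

-- cycles (fixed points included) each starting with its largest element,
-- ordered by increasing largest element, parentheses erased
-- (letters are the 0-based values toℕ x; a shift does not change T)
cycleWord : ∀ {n} → Permutation′ n → List ℕ
cycleWord π =
  map toℕ (concatMap (λ m → if isCycleMax π m then cycleFrom π m else []) (allFin _))

data Tree : Set where
  leaf : Tree
  node : Tree → ℕ → Tree → Tree

-- T(w): root is the smallest letter s, w = u s v, left T(u), right T(v).
-- The fuel argument is ≥ length w, so it never runs out.
buildT : ℕ → List ℕ → Tree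
buildT zero     _        = leaf
buildT (suc f)  []       = leaf
buildT (suc f)  (x ∷ xs) =
  let s  = foldr _⊓_ x xs
      uv = break (λ y → y ℕ.≟ s) (x ∷ xs)
      u  = proj₁ uv
      v  = Data.List.drop 1 (proj₂ uv)
  in node (buildT f u) s (buildT f v)
  where import Data.List

T : List ℕ → Tree
T w = buildT (length w) w

nChildren : Tree → ℕ
nChildren leaf         = 0
nChildren (node l _ r) = isNode l + isNode r
  where
  isNode : Tree → ℕ
  isNode leaf = 0
  isNode (node _ _ _) = 1

-- every vertex has graph degree 1 or 2; the Bool records whether the
-- vertex has a parent (contributing 1 to its degree)
AllDeg12 : Bool → Tree → Set
AllDeg12 p leaf = ⊤
AllDeg12 p (node l s r) =
  (1 ≤ d × d ≤ 2) × AllDeg12 true l × AllDeg12 true r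
  where d = (if p then 1 else 0) + nChildren (node l s r)

TreeSimple : ∀ {n} → Permutation′ n → Set
TreeSimple {n} π = n ≡ 1 ⊎ AllDeg12 false (T (cycleWord π))

powℚ : ℚ → ℕ → ℚ
powℚ b zero    = ℚ.1ℚ
powℚ b (suc k) = b ℚ.* powℚ b k

CardAtLeast : ∀ {ℓ} {n} → (Permutation′ n → Set ℓ) → ℚ → Set ℓ
CardAtLeast {n = n} A c =
  Σ (List (Permutation′ n)) λ xs →
    All A xs × AllPairs (λ σ ρ → ¬ (σ ≈ ρ)) xs × c ℚ.≤ (Data.Integer.+ length xs ℚ./ 1)

ExpGrowth : ∀ {ℓ} → ((n : ℕ) → Permutation′ n → Set ℓ) → Set ℓ
ExpGrowth A =
  Σ ℚ λ a → Σ ℚ λ b → ℚ.0ℚ ℚ.< a × ℚ.1ℚ ℚ.< b ×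
    Σ ℕ λ N → ∀ n → N ≤ n → CardAtLeast (A n) (a ℚ.* powℚ b n)

module Submission where

-- Each family contains 2^q distinct members as soon as n ≥ c + 4q, by an injective construction
-- from bit vectors of length q; since (9/8)⁴ ≤ 2 this gives |A_n| ≥ a (9/8)ⁿ.
-- A product of disjoint transpositions (2i-1 2i) is an involution, hence group-simple, and its
-- reduced word uses each generator at most once, hence it is braid-simple.
-- A zigzag permutation, sending consecutive positions alternately below and above ⌈n/2⌉, stays
-- segment-simple after transposing some of its smallest values.
-- The cycle through a subset of [n] containing 1 and n, in increasing order, is cycle-simple;
-- its cycle word is (fixed points) n 1 (rest of the cycle), whose tree is two increasing paths
-- hanging from the root 1, so it is also tree-simple.

open import Defs
open import Data.Nat.Base
open import Data.Nat.Properties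
open import Data.Nat.DivMod using (_/_; _%_; m≡m%n+[m/n]*n; m%n<n)
import Data.Integer.Base as ℤ
import Data.Integer.Properties as ℤₚ
import Data.Rational as ℚ
open ℚ using (ℚ; 0ℚ; 1ℚ; toℚᵘ)
import Data.Rational.Properties as ℚₚ
import Data.Rational.Unnormalised as ℚᵘ
import Data.Rational.Unnormalised.Properties as ℚᵘₚ
open import Data.Bool.Base using (Bool; true; false; if_then_else_; not; _∧_)
open import Data.Fin.Base using (Fin; zero; suc; toℕ; fromℕ; fromℕ<)
import Data.Fin.Properties as Finₚ
open import Data.Vec.Base using (Vec; []; _∷_)
open import Data.Vec.Properties using (∷-injective)
open import Data.Bool.Properties using (not-¬)
open import Data.List.Base using (List; []; _∷_; length; map; _++_; filter; foldr; break; takeWhile; concatMap; upTo; applyUpTo; allFin; tabulate)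
open import Data.List.Properties using (length-map; length-++; filter-notAll; ++-assoc; ++-identityʳ; map-applyUpTo)
open import Data.List.Relation.Unary.Any as Any using (Any; here; there)
open import Data.List.Membership.Propositional using (_∈_; _∉_)
open import Data.List.Membership.Propositional.Properties using (∈-filter⁺; ∈-allFin)
open import Data.List.Membership.DecPropositional _≟_ using (_∈?_)
open import Data.List.Relation.Unary.Unique.Propositional using (Unique)
open import Data.List.Relation.Unary.All as All using (All; []; _∷_)
import Data.List.Relation.Unary.All.Properties as All
open import Data.List.Relation.Unary.AllPairs as AllPairs using (AllPairs; []; _∷_)
import Data.List.Relation.Unary.AllPairs.Properties as AllPairs
open import Data.Fin.Permutation using (Permutation′; _≈_; _⟨$⟩ʳ_; _⟨$⟩ˡ_; permutation; id; _∘ₚ_; lift₀; inverseʳ; inverseˡ)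
open import Data.Sum.Base using (_⊎_; inj₁; inj₂)
open import Data.Empty using (⊥-elim)
open import Data.Unit.Base using (⊤; tt)
open import Data.Product.Base using (Σ; _×_; _,_; proj₁; proj₂)
open import Function.Definitions using (Injective)
open import Relation.Nullary using (¬_; ¬?; yes; no; Dec)
open import Relation.Nullary.Decidable using (toWitness; dec-true; dec-false)
open import Relation.Binary.Definitions using (DecidableEquality)
open import Relation.Binary.PropositionalEquality

ℕ→ℚ : ℕ → ℚ
ℕ→ℚ m = ℤ.+ m ℚ./ 1

ℕ→ℚ-≃ : ∀ m → toℚᵘ (ℕ→ℚ m) ℚᵘ.≃ ℚᵘ.mkℚᵘ (ℤ.+ m) 0
ℕ→ℚ-≃ m = ℚₚ.toℚᵘ-fromℚᵘ (ℚᵘ.mkℚᵘ (ℤ.+ m) 0)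

ℕ→ℚ-mono-≤ : ∀ {m k} → m ≤ k → ℕ→ℚ m ℚ.≤ ℕ→ℚ k
ℕ→ℚ-mono-≤ {m} {k} m≤k = ℚₚ.toℚᵘ-cancel-≤ (begin
  toℚᵘ (ℕ→ℚ m)   ≃⟨ ℕ→ℚ-≃ m ⟩
  ℚᵘ.mkℚᵘ (ℤ.+ m) 0 ≤⟨ ℚᵘ.*≤* (subst₂ ℤ._≤_ (sym (ℤₚ.*-identityʳ (ℤ.+ m))) (sym (ℤₚ.*-identityʳ (ℤ.+ k)))
                                 (ℤ.+≤+ m≤k)) ⟩
  ℚᵘ.mkℚᵘ (ℤ.+ k) 0 ≃⟨ ℚᵘₚ.≃-sym (ℕ→ℚ-≃ k) ⟩
  toℚᵘ (ℕ→ℚ k)   ∎)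
  where open ℚᵘₚ.≤-Reasoning

ℕ→ℚ-* : ∀ m k → ℕ→ℚ (m * k) ≡ ℕ→ℚ m ℚ.* ℕ→ℚ k
ℕ→ℚ-* m k = ℚₚ.toℚᵘ-injective (begin
  toℚᵘ (ℕ→ℚ (m * k))                     ≈⟨ ℕ→ℚ-≃ (m * k) ⟩
  ℚᵘ.mkℚᵘ (ℤ.+ (m * k)) 0                  ≡⟨ cong (λ z → ℚᵘ.mkℚᵘ z 0) (ℤₚ.pos-* m k) ⟩
  ℚᵘ.mkℚᵘ (ℤ.+ m) 0 ℚᵘ.* ℚᵘ.mkℚᵘ (ℤ.+ k) 0   ≈⟨ ℚᵘₚ.*-cong (ℚᵘₚ.≃-sym (ℕ→ℚ-≃ m)) (ℚᵘₚ.≃-sym (ℕ→ℚ-≃ k)) ⟩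
  toℚᵘ (ℕ→ℚ m) ℚᵘ.* toℚᵘ (ℕ→ℚ k)         ≈⟨ ℚᵘₚ.≃-sym (ℚₚ.toℚᵘ-homo-* (ℕ→ℚ m) (ℕ→ℚ k)) ⟩
  toℚᵘ (ℕ→ℚ m ℚ.* ℕ→ℚ k)                 ∎)
  where open import Relation.Binary.Reasoning.Setoid ℚᵘₚ.≃-setoid

powℚ-ℕ→ℚ : ∀ m q → powℚ (ℕ→ℚ m) q ≡ ℕ→ℚ (m ^ q)
powℚ-ℕ→ℚ m zero    = refl
powℚ-ℕ→ℚ m (suc q) = trans (cong (ℕ→ℚ m ℚ.*_) (powℚ-ℕ→ℚ m q)) (sym (ℕ→ℚ-* m (m ^ q)))

powℚ-distribˡ-+ : ∀ x m n → powℚ x (m + n) ≡ powℚ x m ℚ.* powℚ x n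
powℚ-distribˡ-+ x zero    n = sym (ℚₚ.*-identityˡ _)
powℚ-distribˡ-+ x (suc m) n = trans (cong (x ℚ.*_) (powℚ-distribˡ-+ x m n)) (sym (ℚₚ.*-assoc x _ _))

powℚ-*-assoc : ∀ x m n → powℚ x (m * n) ≡ powℚ (powℚ x m) n
powℚ-*-assoc x m zero    = cong (powℚ x) (*-zeroʳ m)
powℚ-*-assoc x m (suc n) = begin
  powℚ x (m * suc n)              ≡⟨ cong (powℚ x) (*-suc m n) ⟩
  powℚ x (m + m * n)              ≡⟨ powℚ-distribˡ-+ x m (m * n) ⟩
  powℚ x m ℚ.* powℚ x (m * n)     ≡⟨ cong (powℚ x m ℚ.*_) (powℚ-*-assoc x m n) ⟩
  powℚ x m ℚ.* powℚ (powℚ x m) n  ∎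
  where open ≡-Reasoning

powℚ-distrib-* : ∀ x y m → powℚ (x ℚ.* y) m ≡ powℚ x m ℚ.* powℚ y m
powℚ-distrib-* x y zero    = refl
powℚ-distrib-* x y (suc m) = begin
  (x ℚ.* y) ℚ.* powℚ (x ℚ.* y) m          ≡⟨ cong ((x ℚ.* y) ℚ.*_) (powℚ-distrib-* x y m) ⟩
  (x ℚ.* y) ℚ.* (powℚ x m ℚ.* powℚ y m)   ≡⟨ interchange x y (powℚ x m) (powℚ y m) ⟩
  (x ℚ.* powℚ x m) ℚ.* (y ℚ.* powℚ y m)   ∎
  where
  open ≡-Reasoning
  interchange : ∀ a b c d → (a ℚ.* b) ℚ.* (c ℚ.* d) ≡ (a ℚ.* c) ℚ.* (b ℚ.* d)
  interchange a b c d = begin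
    (a ℚ.* b) ℚ.* (c ℚ.* d)   ≡⟨ ℚₚ.*-assoc a b _ ⟩
    a ℚ.* (b ℚ.* (c ℚ.* d))   ≡⟨ cong (a ℚ.*_) (sym (ℚₚ.*-assoc b c d)) ⟩
    a ℚ.* ((b ℚ.* c) ℚ.* d)   ≡⟨ cong (λ z → a ℚ.* (z ℚ.* d)) (ℚₚ.*-comm b c) ⟩
    a ℚ.* ((c ℚ.* b) ℚ.* d)   ≡⟨ cong (a ℚ.*_) (ℚₚ.*-assoc c b d) ⟩
    a ℚ.* (c ℚ.* (b ℚ.* d))   ≡⟨ sym (ℚₚ.*-assoc a c _) ⟩
    (a ℚ.* c) ℚ.* (b ℚ.* d)   ∎

powℚ-1 : ∀ m → powℚ 1ℚ m ≡ 1ℚ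
powℚ-1 zero    = refl
powℚ-1 (suc m) = trans (ℚₚ.*-identityˡ _) (powℚ-1 m)

powℚ-nonNeg : ∀ x m → 0ℚ ℚ.≤ x → 0ℚ ℚ.≤ powℚ x m
powℚ-nonNeg x zero    _   = toWitness {a? = 0ℚ ℚ.≤? 1ℚ} _
powℚ-nonNeg x (suc m) 0≤x = begin
  0ℚ               ≡⟨ sym (ℚₚ.*-zeroʳ x) ⟩
  x ℚ.* 0ℚ         ≤⟨ ℚₚ.*-monoˡ-≤-nonNeg x {{ℚ.nonNegative 0≤x}} (powℚ-nonNeg x m 0≤x) ⟩
  x ℚ.* powℚ x m   ∎
  where open ℚₚ.≤-Reasoning

powℚ-pos : ∀ x m → 0ℚ ℚ.< x → 0ℚ ℚ.< powℚ x m
powℚ-pos x zero    _   = toWitness {a? = 0ℚ ℚ.<? 1ℚ} _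
powℚ-pos x (suc m) 0<x =
  ℚₚ.positive⁻¹ _ {{ℚₚ.pos*pos⇒pos x {{ℚ.positive 0<x}} (powℚ x m) {{ℚ.positive (powℚ-pos x m 0<x)}}}}

powℚ-monoˡ-≤ : ∀ {x y} m → 0ℚ ℚ.≤ x → x ℚ.≤ y → powℚ x m ℚ.≤ powℚ y m
powℚ-monoˡ-≤         zero    _   _   = ℚₚ.≤-refl
powℚ-monoˡ-≤ {x} {y} (suc m) 0≤x x≤y = begin
  x ℚ.* powℚ x m   ≤⟨ ℚₚ.*-monoʳ-≤-nonNeg (powℚ x m) {{ℚ.nonNegative (powℚ-nonNeg x m 0≤x)}} x≤y ⟩
  y ℚ.* powℚ x m   ≤⟨ ℚₚ.*-monoˡ-≤-nonNeg y {{ℚ.nonNegative (ℚₚ.≤-trans 0≤x x≤y)}} (powℚ-monoˡ-≤ m 0≤x x≤y) ⟩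
  y ℚ.* powℚ y m   ∎
  where open ℚₚ.≤-Reasoning

powℚ-monoʳ-≤ : ∀ {x} → 1ℚ ℚ.≤ x → ∀ {m n} → m ≤ n → powℚ x m ℚ.≤ powℚ x n
powℚ-monoʳ-≤ {x} 1≤x {m} {n} m≤n = begin
  powℚ x m                      ≡⟨ sym (ℚₚ.*-identityˡ _) ⟩
  1ℚ ℚ.* powℚ x m               ≤⟨ ℚₚ.*-monoʳ-≤-nonNeg (powℚ x m) {{ℚ.nonNegative (powℚ-nonNeg x m 0≤x)}}
                                                        (powℚ-one≤ (n ∸ m)) ⟩
  powℚ x (n ∸ m) ℚ.* powℚ x m   ≡⟨ sym (powℚ-distribˡ-+ x (n ∸ m) m) ⟩
  powℚ x (n ∸ m + m)            ≡⟨ cong (powℚ x) (m∸n+n≡m m≤n) ⟩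
  powℚ x n                      ∎
  where
  open ℚₚ.≤-Reasoning
  0≤x : 0ℚ ℚ.≤ x
  0≤x = ℚₚ.≤-trans (toWitness {a? = 0ℚ ℚ.≤? 1ℚ} _) 1≤x
  powℚ-one≤ : ∀ k → 1ℚ ℚ.≤ powℚ x k
  powℚ-one≤ k = subst (ℚ._≤ powℚ x k) (powℚ-1 k) (powℚ-monoˡ-≤ k (toWitness {a? = 0ℚ ℚ.≤? 1ℚ} _) 1≤x)

AtLeast : ∀ {ℓ n} → (Permutation′ n → Set ℓ) → ℕ → Set ℓ
AtLeast {n = n} A m =
  Σ (List (Permutation′ n)) λ σs → All A σs × AllPairs (λ σ ρ → ¬ σ ≈ ρ) σs × m ≤ length σs

AtLeast⇒CardAtLeast : ∀ {ℓ n} {A : Permutation′ n → Set ℓ} {m x} →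
                      x ℚ.≤ ℕ→ℚ m → AtLeast A m → CardAtLeast A x
AtLeast⇒CardAtLeast x≤m (σs , all , distinct , m≤len) = σs , all , distinct , ℚₚ.≤-trans x≤m (ℕ→ℚ-mono-≤ m≤len)

AtLeast-mono : ∀ {ℓ n} {A : Permutation′ n → Set ℓ} {m k} → k ≤ m → AtLeast A m → AtLeast A k
AtLeast-mono k≤m (σs , all , distinct , m≤len) = σs , all , distinct , ≤-trans k≤m m≤len

bitVectors : (q : ℕ) → List (Vec Bool q)
bitVectors zero    = [] ∷ []
bitVectors (suc q) = map (true ∷_) (bitVectors q) ++ map (false ∷_) (bitVectors q)

length-bitVectors : ∀ q → length (bitVectors q) ≡ 2 ^ q
length-bitVectors zero    = refl
length-bitVectors (suc q) = begin
  length (map (true ∷_) vs ++ map (false ∷_) vs)            ≡⟨ length-++ (map (true ∷_) vs) ⟩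
  length (map (true ∷_) vs) + length (map (false ∷_) vs)    ≡⟨ cong₂ _+_ (length-map _ vs) (length-map _ vs) ⟩
  length vs + length vs                                     ≡⟨ cong₂ _+_ (length-bitVectors q) (length-bitVectors q) ⟩
  2 ^ q + 2 ^ q                                             ≡⟨ cong (λ z → 2 ^ q + z) (sym (+-identityʳ (2 ^ q))) ⟩
  2 ^ suc q                                                 ∎
  where
  open ≡-Reasoning
  vs = bitVectors q

bitVectors-distinct : ∀ q → AllPairs _≢_ (bitVectors q)
bitVectors-distinct zero    = [] ∷ []
bitVectors-distinct (suc q) = AllPairs.++⁺ (consed true) (consed false)
  (All.map⁺ (All.universal (λ _ → All.map⁺ (All.universal (λ _ ()) (bitVectors q))) (bitVectors q)))
  where
  consed : ∀ b → AllPairs _≢_ (map (b ∷_) (bitVectors q))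
  consed b = AllPairs.map⁺ (AllPairs.map (λ u≢v eq → u≢v (proj₂ (∷-injective eq))) (bitVectors-distinct q))

AtLeast-image : ∀ {ℓ n q} {A : Permutation′ n → Set ℓ} (f : Vec Bool q → Permutation′ n) →
                (∀ v → A (f v)) → Injective _≡_ _≈_ f → AtLeast A (2 ^ q)
AtLeast-image {q = q} f A-f f-injective =
    map f (bitVectors q)
  , All.map⁺ (All.universal A-f (bitVectors q))
  , AllPairs.map⁺ (AllPairs.map (λ u≢v fu≈fv → u≢v (f-injective fu≈fv)) (bitVectors-distinct q))
  , ≤-reflexive (sym (trans (length-map f (bitVectors q)) (length-bitVectors q)))

quarter-bracket : ∀ d → 4 * (d / 4) ≤ d × d ≤ 4 + 4 * (d / 4)
quarter-bracket d = subst (_≤ d) (*-comm (d / 4) 4) lower , subst (d ≤_) upper-eq upper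
  where
  d≡ : d ≡ d % 4 + (d / 4) * 4
  d≡ = m≡m%n+[m/n]*n d 4
  lower : (d / 4) * 4 ≤ d
  lower = subst ((d / 4) * 4 ≤_) (sym d≡) (m≤n+m _ (d % 4))
  upper : d ≤ 4 + (d / 4) * 4
  upper = subst (_≤ 4 + (d / 4) * 4) (sym d≡) (+-monoˡ-≤ _ (<⇒≤ (m%n<n d 4)))
  upper-eq : 4 + (d / 4) * 4 ≡ 4 + 4 * (d / 4)
  upper-eq = cong (4 +_) (*-comm (d / 4) 4)

-- b = 9/8 satisfies b⁴ ≤ 2, and a = b^-(c+4) absorbs the rounding of (n - c)/4.
expGrowth-from-bits : ∀ {ℓ} (A : (n : ℕ) → Permutation′ n → Set ℓ) (c : ℕ) →
                      (∀ q n → c + 4 * q ≤ n → AtLeast (A n) (2 ^ q)) → ExpGrowth A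
expGrowth-from-bits A c many = a , b , 0<a , toWitness {a? = 1ℚ ℚ.<? b} _ , c , large
  where
  b b⁻¹ a : ℚ
  b   = ℤ.+ 9 ℚ./ 8
  b⁻¹ = ℤ.+ 8 ℚ./ 9
  a   = powℚ b⁻¹ (c + 4)

  0<a : 0ℚ ℚ.< a
  0<a = powℚ-pos b⁻¹ (c + 4) (toWitness {a? = 0ℚ ℚ.<? b⁻¹} _)

  0≤a : 0ℚ ℚ.≤ a
  0≤a = ℚₚ.<⇒≤ 0<a

  b⁴≤2 : powℚ b 4 ℚ.≤ ℕ→ℚ 2
  b⁴≤2 = toWitness {a? = powℚ b 4 ℚ.≤? ℕ→ℚ 2} _

  bound : ∀ q n → n ≤ (c + 4) + 4 * q → a ℚ.* powℚ b n ℚ.≤ ℕ→ℚ (2 ^ q)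
  bound q n n≤ = begin
    a ℚ.* powℚ b n                                  ≤⟨ ℚₚ.*-monoˡ-≤-nonNeg a {{ℚ.nonNegative 0≤a}}
                                                         (powℚ-monoʳ-≤ (toWitness {a? = 1ℚ ℚ.≤? b} _) n≤) ⟩
    a ℚ.* powℚ b ((c + 4) + 4 * q)                  ≡⟨ cong (a ℚ.*_) (powℚ-distribˡ-+ b (c + 4) (4 * q)) ⟩
    a ℚ.* (powℚ b (c + 4) ℚ.* powℚ b (4 * q))       ≡⟨ sym (ℚₚ.*-assoc a _ _) ⟩
    (a ℚ.* powℚ b (c + 4)) ℚ.* powℚ b (4 * q)       ≡⟨ cong (ℚ._* powℚ b (4 * q)) a*bᶜ⁺⁴≡1 ⟩
    1ℚ ℚ.* powℚ b (4 * q)                           ≡⟨ ℚₚ.*-identityˡ _ ⟩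
    powℚ b (4 * q)                                  ≡⟨ powℚ-*-assoc b 4 q ⟩
    powℚ (powℚ b 4) q                               ≤⟨ powℚ-monoˡ-≤ q (powℚ-nonNeg b 4 (toWitness {a? = 0ℚ ℚ.≤? b} _)) b⁴≤2 ⟩
    powℚ (ℕ→ℚ 2) q                                  ≡⟨ powℚ-ℕ→ℚ 2 q ⟩
    ℕ→ℚ (2 ^ q)                                     ∎
    where
    open ℚₚ.≤-Reasoning
    a*bᶜ⁺⁴≡1 : a ℚ.* powℚ b (c + 4) ≡ 1ℚ
    a*bᶜ⁺⁴≡1 = trans (sym (powℚ-distrib-* b⁻¹ b (c + 4))) (powℚ-1 (c + 4))

  large : ∀ n → c ≤ n → CardAtLeast (A n) (a ℚ.* powℚ b n)
  large n c≤n = AtLeast⇒CardAtLeast (bound q n n≤) (many q n c+4q≤n)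
    where
    q = (n ∸ c) / 4
    c+d≡n : c + (n ∸ c) ≡ n
    c+d≡n = m+[n∸m]≡n c≤n
    c+4q≤n : c + 4 * q ≤ n
    c+4q≤n = subst (c + 4 * q ≤_) c+d≡n (+-monoʳ-≤ c (proj₁ (quarter-bracket (n ∸ c))))
    n≤ : n ≤ (c + 4) + 4 * q
    n≤ = subst₂ _≤_ c+d≡n (sym (+-assoc c 4 (4 * q))) (+-monoʳ-≤ c (proj₂ (quarter-bracket (n ∸ c))))

2*suc-≤-cancel : ∀ {q n} → 2 * suc q ≤ 2 + n → 2 * q ≤ n
2*suc-≤-cancel {q} {n} le = +-cancelˡ-≤ 2 (2 * q) n (subst (_≤ 2 + n) (*-suc 2 q) le)

2*suc≰1 : ∀ {q} → ¬ 2 * suc q ≤ 1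
2*suc≰1 {q} le with s≤s () ← ≤-trans (subst (_≤ 2 * suc q) (*-identityʳ 2) (*-monoʳ-≤ 2 (s≤s z≤n))) le

swaps : ∀ {n q} → Vec Bool q → Fin n → Fin n
swaps               []       x             = x
swaps {suc zero}    (b ∷ bs) x             = x
swaps {suc (suc n)} (b ∷ bs) zero          = if b then suc zero else zero
swaps {suc (suc n)} (b ∷ bs) (suc zero)    = if b then zero else suc zero
swaps {suc (suc n)} (b ∷ bs) (suc (suc x)) = suc (suc (swaps bs x))

swaps-involutive : ∀ {n q} (bs : Vec Bool q) (x : Fin n) → swaps bs (swaps bs x) ≡ x
swaps-involutive               []           x             = refl
swaps-involutive {suc zero}    (b ∷ bs)     x             = refl
swaps-involutive {suc (suc n)} (true  ∷ bs) zero          = refl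
swaps-involutive {suc (suc n)} (false ∷ bs) zero          = refl
swaps-involutive {suc (suc n)} (true  ∷ bs) (suc zero)    = refl
swaps-involutive {suc (suc n)} (false ∷ bs) (suc zero)    = refl
swaps-involutive {suc (suc n)} (b ∷ bs)     (suc (suc x)) = cong (λ z → suc (suc z)) (swaps-involutive bs x)

swapsPerm : ∀ {n q} → Vec Bool q → Permutation′ n
swapsPerm bs = permutation (swaps bs) (swaps bs) (swaps-involutive bs) (swaps-involutive bs)

swapsPerm-injective : ∀ {n q} → 2 * q ≤ n → Injective _≡_ _≈_ (swapsPerm {n} {q})
swapsPerm-injective {q = zero}        _  {[]}    {[]}    _   = refl
swapsPerm-injective {zero}        {suc q} ()
swapsPerm-injective {suc zero}    {suc q} le                 _   = ⊥-elim (2*suc≰1 le)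
swapsPerm-injective {suc (suc n)} {suc q} le {a ∷ u} {b ∷ v} u≈v =
  cong₂ _∷_ (head-bit a b (u≈v zero))
            (swapsPerm-injective (2*suc-≤-cancel le) (λ x → Finₚ.suc-injective (Finₚ.suc-injective (u≈v (suc (suc x))))))
  where
  head-bit : ∀ a b → (if a then suc zero else zero) ≡ (if b then suc {suc n} zero else zero) → a ≡ b
  head-bit true  true  _ = refl
  head-bit false false _ = refl
  head-bit true  false ()
  head-bit false true  ()

swaps-fixes-above : ∀ {n q} (bs : Vec Bool q) (x : Fin n) → 2 * q ≤ toℕ x → swaps bs x ≡ x
swaps-fixes-above               []       x             _  = refl
swaps-fixes-above {suc zero}    (b ∷ bs) x             _  = refl
swaps-fixes-above {suc (suc n)} (b ∷ bs) zero          ()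
swaps-fixes-above {suc (suc n)} (b ∷ bs) (suc zero)    le = ⊥-elim (2*suc≰1 le)
swaps-fixes-above {suc (suc n)} (b ∷ bs) (suc (suc x)) le =
  cong (λ z → suc (suc z)) (swaps-fixes-above bs x (2*suc-≤-cancel le))

swaps-preserves-below : ∀ {n q} (bs : Vec Bool q) {m} → 2 * q ≤ m → (x : Fin n) → toℕ x < m → toℕ (swaps bs x) < m
swaps-preserves-below               []                           _  x             x<m = x<m
swaps-preserves-below {suc zero}    (b ∷ bs)                     _  x             x<m = x<m
swaps-preserves-below {suc (suc n)} (b ∷ bs)     {zero}          () x             x<m
swaps-preserves-below {suc (suc n)} (b ∷ bs)     {suc zero}      le x             x<m = ⊥-elim (2*suc≰1 le)
swaps-preserves-below {suc (suc n)} (true  ∷ bs) {suc (suc m)}   _  zero          _   = s≤s (s≤s z≤n)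
swaps-preserves-below {suc (suc n)} (false ∷ bs) {suc (suc m)}   _  zero          _   = s≤s z≤n
swaps-preserves-below {suc (suc n)} (true  ∷ bs) {suc (suc m)}   _  (suc zero)    _   = s≤s z≤n
swaps-preserves-below {suc (suc n)} (false ∷ bs) {suc (suc m)}   _  (suc zero)    _   = s≤s (s≤s z≤n)
swaps-preserves-below {suc (suc n)} (b ∷ bs)     {suc (suc m)}   le (suc (suc x)) x<m =
  s≤s (s≤s (swaps-preserves-below bs (2*suc-≤-cancel le) x (s≤s⁻¹ (s≤s⁻¹ x<m))))

powers-of-involution : ∀ {n} (π : Permutation′ n) → (∀ x → fun π (fun π x) ≡ x) →
                       ∀ k → pow π k ≈ id ⊎ pow π k ≈ π
powers-of-involution π π²≗id zero    = inj₁ (λ _ → refl)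
powers-of-involution π π²≗id (suc k) with powers-of-involution π π²≗id k
... | inj₁ πᵏ≈id = inj₂ (λ x → πᵏ≈id (π ⟨$⟩ʳ x))
... | inj₂ πᵏ≈π  = inj₁ (λ x → trans (πᵏ≈π (π ⟨$⟩ʳ x)) (π²≗id x))

involution⇒GroupSimple : ∀ {n} (π : Permutation′ n) → (∀ x → fun π (fun π x) ≡ x) → GroupSimple π
involution⇒GroupSimple π π²≗id H N ((h , Hh , h≉id) , (g , (j , g≈πʲ) , ¬Hg))
  with IsNormalSubgroupOfCyc.inCyc N h Hh
... | k , h≈πᵏ with powers-of-involution π π²≗id k
...   | inj₁ πᵏ≈id = h≉id (λ x → trans (h≈πᵏ x) (πᵏ≈id x))
...   | inj₂ πᵏ≈π  = ¬Hg (H-g (powers-of-involution π π²≗id j))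
  where
  open IsNormalSubgroupOfCyc N
  H-g : pow π j ≈ id ⊎ pow π j ≈ π → H g
  H-g (inj₁ πʲ≈id) = respects id g (λ x → sym (trans (g≈πʲ x) (πʲ≈id x))) hasId
  H-g (inj₂ πʲ≈π)  = respects π g (λ x → sym (trans (g≈πʲ x) (πʲ≈π x)))
                       (respects h π (λ x → trans (h≈πᵏ x) (πᵏ≈π x)) Hh)

Unique-⊆-length : ∀ {A : Set} → DecidableEquality A →
                  ∀ (xs ys : List A) → Unique xs → All (_∈ ys) xs → length xs ≤ length ys
Unique-⊆-length _≟_ []       ys _              _           = z≤n
Unique-⊆-length _≟_ (x ∷ xs) ys (x∉xs ∷ uniq) (x∈ys ∷ xs⊆ys) =
  ≤-trans (s≤s (Unique-⊆-length _≟_ xs ys-x uniq (xs⊆ys-x xs x∉xs xs⊆ys)))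
          (filter-notAll ≢x? ys (Any.map (λ x≡y y≢x → y≢x (sym x≡y)) x∈ys))
  where
  ≢x? = λ y → ¬? (y ≟ x)
  ys-x = filter ≢x? ys
  xs⊆ys-x : ∀ zs → All (x ≢_) zs → All (_∈ ys) zs → All (_∈ ys-x) zs
  xs⊆ys-x []       _              _           = []
  xs⊆ys-x (z ∷ zs) (x≢z ∷ x≢zs) (z∈ys ∷ zs⊆ys) =
    ∈-filter⁺ ≢x? z∈ys (λ z≡x → x≢z (sym z≡x)) ∷ xs⊆ys-x zs x≢zs zs⊆ys

swapWord : ∀ {q} → Vec Bool q → List ℕ
swapWord []           = []
swapWord (true  ∷ bs) = 1 ∷ map (2 +_) (swapWord bs)
swapWord (false ∷ bs) = map (2 +_) (swapWord bs)

LetterBelow : ℕ → ℕ → Set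
LetterBelow q l = 1 ≤ l × l < 2 * q

shift-letters : ∀ {q} w → All (LetterBelow q) w → All (LetterBelow (suc q)) (map (2 +_) w)
shift-letters {q} w ls = All.map⁺ (All.map shift ls)
  where
  shift : ∀ {l} → LetterBelow q l → LetterBelow (suc q) (2 + l)
  shift {l} (1≤l , l<2q) = ≤-trans 1≤l (m≤n+m l 2) , subst (2 + l <_) (sym (*-suc 2 q)) (+-monoʳ-< 2 l<2q)

swapWord-letters : ∀ {q} (bs : Vec Bool q) → All (LetterBelow q) (swapWord bs)
swapWord-letters         []           = []
swapWord-letters {suc q} (true  ∷ bs) =
  (s≤s z≤n , subst (1 <_) (sym (*-suc 2 q)) (s≤s (s≤s z≤n))) ∷ shift-letters (swapWord bs) (swapWord-letters bs)
swapWord-letters         (false ∷ bs) = shift-letters (swapWord bs) (swapWord-letters bs)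

swapWord-increasing : ∀ {q} (bs : Vec Bool q) → AllPairs _<_ (swapWord bs)
swapWord-increasing []           = []
swapWord-increasing (true  ∷ bs) = All.map⁺ (All.universal (λ _ → s≤s (s≤s z≤n)) (swapWord bs))
                                 ∷ AllPairs.map⁺ (AllPairs.map (+-monoʳ-< 2) (swapWord-increasing bs))
swapWord-increasing (false ∷ bs) = AllPairs.map⁺ (AllPairs.map (+-monoʳ-< 2) (swapWord-increasing bs))

swapWord-positive : ∀ {q} (bs : Vec Bool q) → All (1 ≤_) (swapWord bs)
swapWord-positive bs = All.map proj₁ (swapWord-letters bs)

evalWord-shift-0 : ∀ {n} w → evalWord {2 + n} (map (2 +_) w) zero ≡ zero
evalWord-shift-0     []      = refl
evalWord-shift-0 {n} (l ∷ w) rewrite evalWord-shift-0 {n} w = refl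

evalWord-shift-1 : ∀ {n} w → All (1 ≤_) w → evalWord {2 + n} (map (2 +_) w) (suc zero) ≡ suc zero
evalWord-shift-1     []          _         = refl
evalWord-shift-1 {n} (suc l ∷ w) (_ ∷ 1≤w) rewrite evalWord-shift-1 {n} w 1≤w = refl

evalWord-shift-ss : ∀ {n} w → All (1 ≤_) w → (x : Fin n) →
                    evalWord (map (2 +_) w) (suc (suc x)) ≡ suc (suc (evalWord w x))
evalWord-shift-ss []          _         x = refl
evalWord-shift-ss (suc l ∷ w) (_ ∷ 1≤w) x rewrite evalWord-shift-ss w 1≤w x = refl

evalWord-Fin1 : ∀ w (x : Fin 1) → evalWord w x ≡ x
evalWord-Fin1 []      zero = refl
evalWord-Fin1 (l ∷ w) zero rewrite evalWord-Fin1 w zero = sw-Fin1 (l ∸ 1)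
  where
  sw-Fin1 : ∀ i → sw {1} i zero ≡ zero
  sw-Fin1 zero    = refl
  sw-Fin1 (suc i) = refl

evalWord-swapWord : ∀ {n q} (bs : Vec Bool q) (x : Fin n) → evalWord (swapWord bs) x ≡ swaps bs x
evalWord-swapWord               []           x    = refl
evalWord-swapWord {suc zero}    (b ∷ bs)     zero = evalWord-Fin1 (swapWord (b ∷ bs)) zero
evalWord-swapWord {suc (suc n)} (true ∷ bs)  zero
  rewrite evalWord-shift-0 {n} (swapWord bs) = refl
evalWord-swapWord {suc (suc n)} (true ∷ bs)  (suc zero)
  rewrite evalWord-shift-1 {n} (swapWord bs) (swapWord-positive bs) = refl
evalWord-swapWord {suc (suc n)} (true ∷ bs)  (suc (suc x))
  rewrite evalWord-shift-ss (swapWord bs) (swapWord-positive bs) x | evalWord-swapWord bs x = refl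
evalWord-swapWord {suc (suc n)} (false ∷ bs) zero       = evalWord-shift-0 {n} (swapWord bs)
evalWord-swapWord {suc (suc n)} (false ∷ bs) (suc zero) = evalWord-shift-1 {n} (swapWord bs) (swapWord-positive bs)
evalWord-swapWord {suc (suc n)} (false ∷ bs) (suc (suc x))
  rewrite evalWord-shift-ss (swapWord bs) (swapWord-positive bs) x | evalWord-swapWord bs x = refl

sw-cases : ∀ {n} j (x : Fin n) → (toℕ x ≡ j × toℕ (sw j x) ≡ suc j)
                               ⊎ (toℕ x ≡ suc j × toℕ (sw j x) ≡ j)
                               ⊎ toℕ (sw j x) ≡ toℕ x
sw-cases {suc (suc n)} zero    zero          = inj₁ (refl , refl)
sw-cases {suc (suc n)} zero    (suc zero)    = inj₂ (inj₁ (refl , refl))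
sw-cases {suc (suc n)} zero    (suc (suc x)) = inj₂ (inj₂ refl)
sw-cases {suc zero}    zero    zero          = inj₂ (inj₂ refl)
sw-cases               (suc i) zero          = inj₂ (inj₂ refl)
sw-cases               (suc i) (suc x) with sw-cases i x
... | inj₁ (x≡i , swx≡1+i)        = inj₁ (cong suc x≡i , cong suc swx≡1+i)
... | inj₂ (inj₁ (x≡1+i , swx≡i)) = inj₂ (inj₁ (cong suc x≡1+i , cong suc swx≡i))
... | inj₂ (inj₂ swx≡x)           = inj₂ (inj₂ (cong suc swx≡x))

τ-preserves-below : ∀ {n} l i → 1 ≤ i → i ≢ l → (x : Fin n) → toℕ x < l → toℕ (τ i x) < l
τ-preserves-below l (suc j) _ j+1≢l x x<l with sw-cases j x
... | inj₁ (x≡j , swx≡1+j) rewrite swx≡1+j = ≤∧≢⇒< (subst (λ z → suc z ≤ l) x≡j x<l) j+1≢l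
... | inj₂ (inj₁ (x≡1+j , swx≡j)) rewrite swx≡j = <-trans (n<1+n j) (subst (_< l) x≡1+j x<l)
... | inj₂ (inj₂ swx≡x) rewrite swx≡x = x<l

evalWord-preserves-below : ∀ {n} l w → All (1 ≤_) w → l ∉ w → (x : Fin n) → toℕ x < l → toℕ (evalWord w x) < l
evalWord-preserves-below l []      _          _   x x<l = x<l
evalWord-preserves-below l (i ∷ w) (1≤i ∷ 1≤w) l∉ x x<l =
  τ-preserves-below l i 1≤i (λ i≡l → l∉ (here (sym i≡l))) (evalWord w x)
    (evalWord-preserves-below l w 1≤w (λ l∈w → l∉ (there l∈w)) x x<l)

Crosses : ∀ {n} → (Fin n → Fin n) → ℕ → Set
Crosses f l = Σ _ λ x → toℕ x < l × l ≤ toℕ (f x)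

Crosses-shift : ∀ {n q l} b (bs : Vec Bool q) → Crosses (swaps {n} bs) l → Crosses (swaps {2 + n} (b ∷ bs)) (2 + l)
Crosses-shift b bs (x , x<l , l≤) = suc (suc x) , s≤s (s≤s x<l) , s≤s (s≤s l≤)

swaps-crosses-letters : ∀ {n q} (bs : Vec Bool q) → 2 * q ≤ n → All (Crosses (swaps {n} bs)) (swapWord bs)
swaps-crosses-letters               []           _  = []
swaps-crosses-letters {zero}        (b ∷ bs)     ()
swaps-crosses-letters {suc zero}    (b ∷ bs)     le = ⊥-elim (2*suc≰1 le)
swaps-crosses-letters {suc (suc n)} (true ∷ bs)  le =
  (zero , s≤s z≤n , s≤s z≤n) ∷ All.map⁺ (All.map (Crosses-shift true bs) (swaps-crosses-letters bs (2*suc-≤-cancel le)))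
swaps-crosses-letters {suc (suc n)} (false ∷ bs) le =
  All.map⁺ (All.map (Crosses-shift false bs) (swaps-crosses-letters bs (2*suc-≤-cancel le)))

crossing-letter-occurs : ∀ {n} (f : Fin n → Fin n) l w → All (1 ≤_) w → (∀ x → evalWord w x ≡ f x) →
                         Crosses f l → l ∈ w
crossing-letter-occurs f l w 1≤w w≗f (x , x<l , l≤fx) with l ∈? w
... | yes l∈w = l∈w
... | no  l∉w = ⊥-elim (<⇒≱ (subst (λ z → toℕ z < l) (w≗f x) (evalWord-preserves-below l w 1≤w l∉w x x<l)) l≤fx)

blocksWord-singletons : ∀ w → blocksWord (map (λ k → k , k) w) ≡ w
blocksWord-singletons []      = refl
blocksWord-singletons (k ∷ w) rewrite n∸n≡0 k = cong (k ∷_) (blocksWord-singletons w)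

-- Read as blocks D(l, l), swapWord bs is the normal form: it is reduced because a word
-- without the letter l never moves a point across the gap between l - 1 and l.
swapsPerm-BraidSimple : ∀ {n q} (bs : Vec Bool q) → 2 * q ≤ n → BraidSimple (swapsPerm {n} bs)
swapsPerm-BraidSimple {n} bs 2q≤n = inj₂ (blocks , (shape , evaluates , reduced) , unique)
  where
  w = swapWord bs
  blocks = map (λ k → k , k) w
  shape : BlocksShape n blocks
  shape = All.map⁺ (All.map (λ (1≤l , l<2q) → 1≤l , ≤-refl , ≤-trans (<⇒≤pred l<2q) (∸-monoˡ-≤ 1 2q≤n))
                            (swapWord-letters bs))
        , AllPairs.map⁺ (swapWord-increasing bs)
  evaluates : ∀ x → evalWord (blocksWord blocks) x ≡ fun (swapsPerm bs) x
  evaluates x rewrite blocksWord-singletons w = evalWord-swapWord bs x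
  reduced : Reduced (swapsPerm bs) (blocksWord blocks)
  reduced rewrite blocksWord-singletons w = λ (v , letters , shorter , v≗) →
    <⇒≱ shorter (Unique-⊆-length _≟_ w v (AllPairs.map <⇒≢ (swapWord-increasing bs))
      (All.map (crossing-letter-occurs (swaps bs) _ v (All.map proj₁ letters) v≗) (swaps-crosses-letters bs 2q≤n)))
  unique : Unique (blocksWord blocks)
  unique rewrite blocksWord-singletons w = AllPairs.map <⇒≢ (swapWord-increasing bs)

2q≤4q : ∀ q → 2 * q ≤ 4 * q
2q≤4q q = *-monoˡ-≤ q {2} {4} (s≤s (s≤s z≤n))

many-GroupSimple : ∀ q n → 4 * q ≤ n → AtLeast (GroupSimple {n}) (2 ^ q)
many-GroupSimple q n 4q≤n =
  AtLeast-image {q = q} swapsPerm (λ bs → involution⇒GroupSimple (swapsPerm bs) (swaps-involutive bs))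
                (swapsPerm-injective (≤-trans (2q≤4q q) 4q≤n))

many-BraidSimple : ∀ q n → 4 * q ≤ n → AtLeast (BraidSimple {n}) (2 ^ q)
many-BraidSimple q n 4q≤n =
  AtLeast-image {q = q} swapsPerm (λ bs → swapsPerm-BraidSimple bs (≤-trans (2q≤4q q) 4q≤n))
                (swapsPerm-injective (≤-trans (2q≤4q q) 4q≤n))

fun-injective : ∀ {n} (π : Permutation′ n) {x y} → fun π x ≡ fun π y → x ≡ y
fun-injective π {x} {y} πx≡πy = trans (sym (inverseˡ π)) (trans (cong (π ⟨$⟩ˡ_) πx≡πy) (inverseˡ π))

toℕ-fun-inverse : ∀ {n} (π : Permutation′ n) {v} (v<n : v < n) → toℕ (fun π (π ⟨$⟩ˡ fromℕ< v<n)) ≡ v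
toℕ-fun-inverse π v<n = trans (cong toℕ (inverseʳ π)) (Finₚ.toℕ-fromℕ< v<n)

record SegSimpleCriterion {n} (π : Permutation′ n) : Set where
  field
    threshold    : ℕ
    alternates   : ∀ (x y : Fin n) → toℕ y ≡ suc (toℕ x) →
                   (toℕ (fun π x) < threshold × threshold ≤ toℕ (fun π y))
                   ⊎ (threshold ≤ toℕ (fun π x) × toℕ (fun π y) < threshold)
    first↦       : ∀ z → toℕ z ≡ 0 → toℕ (fun π z) ≡ pred threshold
    late         : Fin n
    late-is-late : n ∸ 2 ≤ toℕ late
    late↦        : toℕ (fun π late) ≡ threshold
    last↦        : ∀ z → toℕ z ≡ pred n → toℕ (fun π z) ≢ 0 × toℕ (fun π z) ≢ pred n

-- An interval I of size ≥ 2 with a segment image contains two adjacent positions, so its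
-- image contains threshold - 1 = π(0) and threshold = π(late); hence I ⊇ [0, n - 2], so the
-- image contains 0 and n - 1 and therefore everything.
criterion⇒SegSimple : ∀ {n} (π : Permutation′ n) → SegSimpleCriterion π → SegSimple π
criterion⇒SegSimple {n} π C (i , j , i≤j , j<n , 1<size , size<n , k , l , l<n , k≤l , onto) =
  <-irrefl refl (<-≤-trans 1+j<n (subst (_≤ suc j) (suc-pred n {{>-nonZero 0<n}}) (s≤s pred-n≤j)))
  where
  open SegSimpleCriterion C renaming (threshold to h)

  0<n : 0 < n
  0<n = ≤-<-trans z≤n (Finₚ.toℕ<n late)

  pred-n<n : pred n < n
  pred-n<n = subst (pred n <_) (suc-pred n {{>-nonZero 0<n}}) (n<1+n (pred n))

  image-in : ∀ {x} → InSeg i j x → InSeg k l (fun π x)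
  image-in x∈I = proj₂ (onto _) (_ , x∈I , refl)

  preimage-in : ∀ {x} → InSeg k l (fun π x) → InSeg i j x
  preimage-in {x} πx∈J with proj₁ (onto (fun π x)) πx∈J
  ... | x′ , x′∈I , πx′≡πx = subst (InSeg i j) (fun-injective π πx′≡πx) x′∈I

  position : ∀ {m} → m < n → Fin n
  position m<n = fromℕ< m<n

  position-in : ∀ {m} (m<n : m < n) → i ≤ m → m ≤ j → InSeg i j (position m<n)
  position-in m<n i≤m m≤j = subst (λ v → i ≤ v × v ≤ j) (sym (Finₚ.toℕ-fromℕ< m<n)) (i≤m , m≤j)

  1+i≤j : suc i ≤ j
  1+i≤j = s≤s⁻¹ (subst (2 + i ≤_) (+-comm j 1) (m≤o∸n⇒m+n≤o 2 (≤-trans i≤j (m≤m+n j 1)) 1<size))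

  i<n : i < n
  i<n = ≤-<-trans (n≤1+n i) (≤-<-trans 1+i≤j j<n)

  1+i<n : suc i < n
  1+i<n = ≤-<-trans 1+i≤j j<n

  i∈I : InSeg i j (position i<n)
  i∈I = position-in i<n ≤-refl i≤j

  1+i∈I : InSeg i j (position 1+i<n)
  1+i∈I = position-in 1+i<n (n≤1+n i) 1+i≤j

  straddles : k < h × h ≤ l
  straddles with alternates (position i<n) (position 1+i<n)
                            (trans (Finₚ.toℕ-fromℕ< 1+i<n) (cong suc (sym (Finₚ.toℕ-fromℕ< i<n))))
  ... | inj₁ (πᵢ<h , h≤πᵢ₊₁) = ≤-<-trans (proj₁ (image-in i∈I)) πᵢ<h , ≤-trans h≤πᵢ₊₁ (proj₂ (image-in 1+i∈I))
  ... | inj₂ (h≤πᵢ , πᵢ₊₁<h) = ≤-<-trans (proj₁ (image-in 1+i∈I)) πᵢ₊₁<h , ≤-trans h≤πᵢ (proj₂ (image-in i∈I))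

  i≤0 : i ≤ 0
  i≤0 = subst (i ≤_) (Finₚ.toℕ-fromℕ< 0<n) (proj₁ (preimage-in in-J))
    where
    in-J = subst (λ m → k ≤ m × m ≤ l) (sym (first↦ (position 0<n) (Finₚ.toℕ-fromℕ< 0<n)))
                 (<⇒≤pred (proj₁ straddles) , ≤-trans pred[n]≤n (proj₂ straddles))

  late≤j : toℕ late ≤ j
  late≤j = proj₂ (preimage-in (subst (λ m → k ≤ m × m ≤ l) (sym late↦) (<⇒≤ (proj₁ straddles) , proj₂ straddles)))

  1+j<n : suc j < n
  1+j<n = subst (_< n) (+-comm j 1) (subst (λ z → j + 1 ∸ z < n) (n≤0⇒n≡0 i≤0) size<n)

  all-but-last-in : ∀ z → toℕ z ≢ pred n → InSeg i j z
  all-but-last-in z z≢last =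
    ≤-trans i≤0 z≤n , ≤-trans (≤pred-pred (Finₚ.toℕ<n z) z≢last) (≤-trans late-is-late late≤j)
    where
    ≤pred-pred : ∀ {x} → x < n → x ≢ pred n → x ≤ n ∸ 2
    ≤pred-pred {x} x<n x≢ = subst (x ≤_) (pred[m∸n]≡m∸[1+n] n 1) (<⇒≤pred (≤∧≢⇒< (<⇒≤pred x<n) x≢))

  value-in-image : ∀ {v} (v<n : v < n) → (∀ z → toℕ z ≡ pred n → toℕ (fun π z) ≢ v) → k ≤ v × v ≤ l
  value-in-image v<n last↛v = subst (λ m → k ≤ m × m ≤ l) (toℕ-fun-inverse π v<n)
    (image-in (all-but-last-in _ (λ w≡last → last↛v _ w≡last (toℕ-fun-inverse π v<n))))

  pred-n≤j : pred n ≤ j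
  pred-n≤j = subst (_≤ j) (Finₚ.toℕ-fromℕ< pred-n<n) (proj₂ (preimage-in (k≤π , π≤l)))
    where
    k≤π = ≤-trans (proj₁ (value-in-image 0<n (λ z z≡last → proj₁ (last↦ z z≡last)))) z≤n
    π≤l = ≤-trans (<⇒≤pred (Finₚ.toℕ<n _)) (proj₂ (value-in-image pred-n<n (λ z z≡last → proj₂ (last↦ z z≡last))))

odd : ℕ → Bool
odd zero          = false
odd (suc zero)    = true
odd (suc (suc x)) = odd x

odd-suc : ∀ x → odd (suc x) ≡ not (odd x)
odd-suc zero          = refl
odd-suc (suc zero)    = refl
odd-suc (suc (suc x)) = odd-suc x

odd-adjacent : ∀ {x y} → y ≡ suc x → odd y ≢ odd x
odd-adjacent {x} refl oy≡ox = not-¬ refl (trans (sym oy≡ox) (odd-suc x))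

odd-double : ∀ s → odd (s + s) ≡ false
odd-double zero    = refl
odd-double (suc s) rewrite +-suc s s = odd-double s

odd-1+double : ∀ s → odd (suc (s + s)) ≡ true
odd-1+double zero    = refl
odd-1+double (suc s) rewrite +-suc s s = odd-1+double s

parity-split : ∀ x → (odd x ≡ false × x ≡ ⌊ x /2⌋ + ⌊ x /2⌋) ⊎ (odd x ≡ true × x ≡ suc (⌊ x /2⌋ + ⌊ x /2⌋))
parity-split zero          = inj₁ (refl , refl)
parity-split (suc zero)    = inj₂ (refl , refl)
parity-split (suc (suc x)) with parity-split x
... | inj₁ (even , x≡) = inj₁ (even , cong suc (trans (cong suc x≡) (sym (+-suc ⌊ x /2⌋ ⌊ x /2⌋))))
... | inj₂ (odd′ , x≡) = inj₂ (odd′ , cong (λ z → suc (suc z)) (trans x≡ (sym (+-suc ⌊ x /2⌋ ⌊ x /2⌋))))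

half-double : ∀ s → ⌊ s + s /2⌋ ≡ s
half-double s = sym (n≡⌊n+n/2⌋ s)

half-1+double : ∀ s → ⌊ suc (s + s) /2⌋ ≡ s
half-1+double s = sym (n≡⌈n+n/2⌉ s)

ℕ-permutation : (n : ℕ) (f g : ℕ → ℕ) → (∀ {x} → x < n → f x < n) → (∀ {y} → y < n → g y < n) →
                (∀ {x} → x < n → g (f x) ≡ x) → (∀ {y} → y < n → f (g y) ≡ y) → Permutation′ n
ℕ-permutation n f g f< g< gf fg =
  permutation (lift f f<) (lift g g<) (inverse {f} {g} {f<} {g<} fg) (inverse {g} {f} {g<} {f<} gf)
  where
  lift : (h : ℕ → ℕ) → (∀ {x} → x < n → h x < n) → Fin n → Fin n
  lift h h< x = fromℕ< (h< (Finₚ.toℕ<n x))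
  inverse : ∀ {h k : ℕ → ℕ} {h< : ∀ {x} → x < n → h x < n} {k< : ∀ {x} → x < n → k x < n} →
            (∀ {y} → y < n → h (k y) ≡ y) → ∀ y → lift h h< (lift k k< y) ≡ y
  inverse {h} hk y = Finₚ.toℕ-injective
    (trans (Finₚ.toℕ-fromℕ< _) (trans (cong h (Finₚ.toℕ-fromℕ< _)) (hk (Finₚ.toℕ<n y))))

toℕ-ℕ-permutation : (n : ℕ) (f g : ℕ → ℕ) (f< : ∀ {x} → x < n → f x < n) (g< : ∀ {y} → y < n → g y < n)
                    (gf : ∀ {x} → x < n → g (f x) ≡ x) (fg : ∀ {y} → y < n → f (g y) ≡ y) (x : Fin n) →
                    toℕ (fun (ℕ-permutation n f g f< g< gf fg) x) ≡ f (toℕ x)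
toℕ-ℕ-permutation n f g f< g< gf fg x = Finₚ.toℕ-fromℕ< _

-- zig sends the even positions 0, 2, 4, … to h - 1, 0, 1, … and the odd positions
-- 1, 3, 5, … to n - 1, n - 2, …; h and o = t + 1 are the numbers of even and odd positions.
module Zigzag (h t : ℕ) (1+t≤h : suc t ≤ h) (h≤2+t : h ≤ 2 + t) where

  o n : ℕ
  o = suc t
  n = h + o

  pred-n≡h+t : pred n ≡ h + t
  pred-n≡h+t = cong pred (+-suc h t)

  pred-n<n : pred n < n
  pred-n<n = subst₂ _<_ (sym pred-n≡h+t) (sym (+-suc h t)) (n<1+n (h + t))

  0<h : 0 < h
  0<h = ≤-trans (s≤s z≤n) 1+t≤h

  1+pred-h≡h : suc (pred h) ≡ h
  1+pred-h≡h = suc-pred h {{>-nonZero 0<h}}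

  pred-h<h : pred h < h
  pred-h<h = subst (pred h <_) 1+pred-h≡h (n<1+n (pred h))

  double<n⇒<h : ∀ {s} → s + s < n → s < h
  double<n⇒<h lt = ≰⇒> (λ h≤s → <⇒≱ lt (+-mono-≤ h≤s (≤-trans 1+t≤h h≤s)))

  <h⇒double<n : ∀ {s} → s < h → s + s < n
  <h⇒double<n s<h = +-mono-≤ s<h (s≤s⁻¹ (≤-trans s<h h≤2+t))

  1+double<n⇒<o : ∀ {s} → suc (s + s) < n → s < o
  1+double<n⇒<o lt = ≰⇒> (λ o≤s → <⇒≱ lt (+-mono-≤ (≤-trans h≤2+t (s≤s o≤s)) o≤s))

  <o⇒1+double<n : ∀ {s} → s < o → suc (s + s) < n
  <o⇒1+double<n {s} s<o = subst (_≤ n) (cong suc (+-suc s s)) (+-mono-≤ (≤-trans s<o 1+t≤h) s<o)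

  low : ℕ → ℕ
  low zero    = pred h
  low (suc s) = s

  zig : ℕ → ℕ
  zig x = if odd x then pred n ∸ ⌊ x /2⌋ else low ⌊ x /2⌋

  low<h : ∀ {s} → s < h → low s < h
  low<h {zero}  _   = pred-h<h
  low<h {suc s} s<h = <-trans (n<1+n s) s<h

  high : ∀ {s} → s < o → h ≤ pred n ∸ s
  high {s} s<o = m+n≤o⇒m≤o∸n h (subst (h + s ≤_) (sym pred-n≡h+t) (+-monoʳ-≤ h (s≤s⁻¹ s<o)))

  zig-side : ∀ {x} → x < n → (odd x ≡ false × zig x < h) ⊎ (odd x ≡ true × h ≤ zig x)
  zig-side {x} x<n with parity-split x
  ... | inj₁ (even , x≡) rewrite even = inj₁ (refl , low<h (double<n⇒<h {⌊ x /2⌋} (subst (_< n) x≡ x<n)))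
  ... | inj₂ (odd′ , x≡) rewrite odd′ = inj₂ (refl , high (1+double<n⇒<o {⌊ x /2⌋} (subst (_< n) x≡ x<n)))

  zig<n : ∀ {x} → x < n → zig x < n
  zig<n {x} x<n with parity-split x
  ... | inj₁ (even , x≡) rewrite even = <-≤-trans (low<h (double<n⇒<h {⌊ x /2⌋} (subst (_< n) x≡ x<n))) (m≤m+n h o)
  ... | inj₂ (odd′ , _)  rewrite odd′ = ≤-<-trans (m∸n≤m (pred n) ⌊ x /2⌋) pred-n<n

  unzig′ : (y : ℕ) → Dec (y < h) → Dec (suc y ≡ h) → ℕ
  unzig′ y (yes _) (yes _) = 0
  unzig′ y (yes _) (no _)  = suc y + suc y
  unzig′ y (no _)  _       = suc ((pred n ∸ y) + (pred n ∸ y))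

  unzig : ℕ → ℕ
  unzig y = unzig′ y (y <? h) (suc y ≟ h)

  unzig<n : ∀ {y} → y < n → unzig y < n
  unzig<n {y} y<n = by-cases (y <? h) (suc y ≟ h)
    where
    by-cases : ∀ d e → unzig′ y d e < n
    by-cases (no y≮h)  _          = <o⇒1+double<n (s≤s (≤-trans (∸-monoʳ-≤ (pred n) (≮⇒≥ y≮h))
                                     (≤-reflexive (trans (cong (_∸ h) pred-n≡h+t) (m+n∸m≡n h t)))))
    by-cases (yes _)   (yes _)    = ≤-<-trans z≤n y<n
    by-cases (yes y<h) (no 1+y≢h) = <h⇒double<n (≤∧≢⇒< y<h 1+y≢h)

  unzig-low : ∀ {s} → s < h → unzig (low s) ≡ s + s
  unzig-low {zero} _ = by-cases (pred h <? h) (suc (pred h) ≟ h)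
    where
    by-cases : ∀ d e → unzig′ (pred h) d e ≡ 0
    by-cases (no ≮)  _       = ⊥-elim (≮ pred-h<h)
    by-cases (yes _) (yes _) = refl
    by-cases (yes _) (no ≢)  = ⊥-elim (≢ 1+pred-h≡h)
  unzig-low {suc s} 1+s<h = by-cases (s <? h) (suc s ≟ h)
    where
    by-cases : ∀ d e → unzig′ s d e ≡ suc s + suc s
    by-cases (no ≮)  _           = ⊥-elim (≮ (<-trans (n<1+n s) 1+s<h))
    by-cases (yes _) (yes 1+s≡h) = ⊥-elim (<-irrefl 1+s≡h 1+s<h)
    by-cases (yes _) (no _)      = refl

  unzig-high : ∀ {s} → s < o → unzig (pred n ∸ s) ≡ suc (s + s)
  unzig-high {s} s<o = by-cases (pred n ∸ s <? h) (suc (pred n ∸ s) ≟ h)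
    where
    by-cases : ∀ d e → unzig′ (pred n ∸ s) d e ≡ suc (s + s)
    by-cases (yes <h) _ = ⊥-elim (<⇒≱ <h (high s<o))
    by-cases (no _)   _ rewrite m∸[m∸n]≡n (≤-trans (s≤s⁻¹ s<o) (subst (t ≤_) (sym pred-n≡h+t) (m≤n+m t h))) = refl

  unzig-zig : ∀ {x} → x < n → unzig (zig x) ≡ x
  unzig-zig {x} x<n with parity-split x
  ... | inj₁ (even , x≡) rewrite even = trans (unzig-low (double<n⇒<h {⌊ x /2⌋} (subst (_< n) x≡ x<n))) (sym x≡)
  ... | inj₂ (odd′ , x≡) rewrite odd′ = trans (unzig-high (1+double<n⇒<o {⌊ x /2⌋} (subst (_< n) x≡ x<n))) (sym x≡)

  zig-unzig : ∀ {y} → y < n → zig (unzig y) ≡ y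
  zig-unzig {y} y<n = by-cases (y <? h) (suc y ≟ h)
    where
    by-cases : ∀ d e → zig (unzig′ y d e) ≡ y
    by-cases (no _)  _           rewrite odd-1+double (pred n ∸ y) | half-1+double (pred n ∸ y)
                               = m∸[m∸n]≡n (<⇒≤pred y<n)
    by-cases (yes _) (yes 1+y≡h) = cong pred (sym 1+y≡h)
    by-cases (yes _) (no _)      rewrite odd-double (suc y) | half-double (suc y) = refl

  zigzag : Permutation′ n
  zigzag = ℕ-permutation n zig unzig zig<n unzig<n unzig-zig zig-unzig

  toℕ-zigzag : ∀ x → toℕ (fun zigzag x) ≡ zig (toℕ x)
  toℕ-zigzag = toℕ-ℕ-permutation n zig unzig zig<n unzig<n unzig-zig zig-unzig

  late : ℕ
  late = suc (t + t)

  late<n : late < n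
  late<n = <o⇒1+double<n (n<1+n t)

  late-is-late : n ∸ 2 ≤ late
  late-is-late = ≤-trans (∸-monoˡ-≤ 2 (+-monoˡ-≤ o h≤2+t)) (≤-reflexive (+-suc t t))

  zig-late : zig late ≡ h
  zig-late rewrite odd-1+double t | half-1+double t = trans (cong (_∸ t) pred-n≡h+t) (m+n∸n≡m h t)

  zig-last : zig (pred n) ≡ h ⊎ zig (pred n) ≡ t
  zig-last with m≤n⇒m<n∨m≡n h≤2+t
  ... | inj₁ h<2+t = inj₁ (trans (cong (λ h′ → zig (pred (h′ + o))) h≡o)
                              (trans (cong zig (+-suc t t)) zig-late))
    where
    h≡o : h ≡ o
    h≡o = ≤-antisym (s≤s⁻¹ h<2+t) 1+t≤h
  ... | inj₂ h≡2+t = inj₂ (trans (cong (λ h′ → zig (pred (h′ + o))) h≡2+t) low-o)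
    where
    low-o : zig (o + o) ≡ t
    low-o rewrite odd-double o | half-double o = refl

  module Family (q : ℕ) (2q<t : 2 * q < t) where

    2q≤h : 2 * q ≤ h
    2q≤h = ≤-trans (<⇒≤ 2q<t) (<⇒≤ 1+t≤h)

    2q≤pred-h : 2 * q ≤ pred h
    2q≤pred-h = ≤-trans (<⇒≤ 2q<t) (<⇒≤pred 1+t≤h)

    0<t : 0 < t
    0<t = ≤-trans (s≤s z≤n) 2q<t

    zig-last-bounds : 2 * q ≤ zig (pred n) × zig (pred n) ≢ 0 × zig (pred n) ≢ pred n
    zig-last-bounds with zig-last
    ... | inj₁ ≡h = subst (λ v → 2 * q ≤ v × v ≢ 0 × v ≢ pred n) (sym ≡h)
                      (2q≤h , (λ h≡0 → <-irrefl (sym h≡0) 0<h) , λ h≡ → <-irrefl (trans h≡ pred-n≡h+t) (m<m+n h 0<t))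
    ... | inj₂ ≡t = subst (λ v → 2 * q ≤ v × v ≢ 0 × v ≢ pred n) (sym ≡t)
                      (<⇒≤ 2q<t , (λ t≡0 → <-irrefl (sym t≡0) 0<t) , λ t≡ → <-irrefl (trans t≡ pred-n≡h+t) (m<n+m t 0<h))

    -- ∘ₚ is diagrammatic: first zig, then swap among the values below 2q, which are all low.
    zigzagSwaps : Vec Bool q → Permutation′ n
    zigzagSwaps bs = zigzag ∘ₚ swapsPerm bs

    zigzagSwaps-injective : Injective _≡_ _≈_ zigzagSwaps
    zigzagSwaps-injective {u} {v} u≈v = swapsPerm-injective (≤-trans 2q≤h (m≤m+n h o)) λ y → begin
      swaps u y                            ≡⟨ cong (swaps u) (sym (inverseʳ zigzag)) ⟩
      swaps u (fun zigzag (zigzag ⟨$⟩ˡ y)) ≡⟨ u≈v (zigzag ⟨$⟩ˡ y) ⟩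
      swaps v (fun zigzag (zigzag ⟨$⟩ˡ y)) ≡⟨ cong (swaps v) (inverseʳ zigzag) ⟩
      swaps v y                            ∎
      where open ≡-Reasoning

    module _ (bs : Vec Bool q) where

      value : Fin n → ℕ
      value x = toℕ (fun (zigzagSwaps bs) x)

      value-fixed : ∀ x → 2 * q ≤ zig (toℕ x) → value x ≡ zig (toℕ x)
      value-fixed x le = trans (cong toℕ (swaps-fixes-above bs (fun zigzag x) (subst (2 * q ≤_) (sym (toℕ-zigzag x)) le)))
                               (toℕ-zigzag x)

      value-at : ∀ {z m} → toℕ z ≡ m → 2 * q ≤ zig m → value z ≡ zig m
      value-at {z} refl le = value-fixed z le

      value-side : ∀ x → (odd (toℕ x) ≡ false × value x < h) ⊎ (odd (toℕ x) ≡ true × h ≤ value x)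
      value-side x with zig-side (Finₚ.toℕ<n x)
      ... | inj₁ (even , zig<h) =
        inj₁ (even , swaps-preserves-below bs 2q≤h (fun zigzag x) (subst (_< h) (sym (toℕ-zigzag x)) zig<h))
      ... | inj₂ (odd′ , h≤zig) = inj₂ (odd′ , subst (h ≤_) (sym (value-fixed x (≤-trans 2q≤h h≤zig))) h≤zig)

      value-alternates : ∀ x y → toℕ y ≡ suc (toℕ x) → (value x < h × h ≤ value y) ⊎ (h ≤ value x × value y < h)
      value-alternates x y y≡1+x with value-side x | value-side y
      ... | inj₁ (_ , x<h) | inj₂ (_ , h≤y) = inj₁ (x<h , h≤y)
      ... | inj₂ (_ , h≤x) | inj₁ (_ , y<h) = inj₂ (h≤x , y<h)
      ... | inj₁ (ex , _)  | inj₁ (ey , _)  = ⊥-elim (odd-adjacent y≡1+x (trans ey (sym ex)))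
      ... | inj₂ (ox , _)  | inj₂ (oy , _)  = ⊥-elim (odd-adjacent y≡1+x (trans oy (sym ox)))

      criterion : SegSimpleCriterion (zigzagSwaps bs)
      criterion = record
        { threshold    = h
        ; alternates   = value-alternates
        ; first↦       = λ z z≡0 → value-at z≡0 2q≤pred-h
        ; late         = fromℕ< late<n
        ; late-is-late = subst (n ∸ 2 ≤_) (sym (Finₚ.toℕ-fromℕ< late<n)) late-is-late
        ; late↦        = trans (value-at (Finₚ.toℕ-fromℕ< late<n) (subst (2 * q ≤_) (sym zig-late) 2q≤h)) zig-late
        ; last↦        = λ z z≡last → let v≡ = value-at z≡last (proj₁ zig-last-bounds) in
                           (λ v≡0 → proj₁ (proj₂ zig-last-bounds) (trans (sym v≡) v≡0))
                         , (λ v≡ₙ → proj₂ (proj₂ zig-last-bounds) (trans (sym v≡) v≡ₙ))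
        }

ceil-half≤1+floor-half : ∀ n → ⌈ n /2⌉ ≤ suc ⌊ n /2⌋
ceil-half≤1+floor-half zero          = z≤n
ceil-half≤1+floor-half (suc zero)    = s≤s z≤n
ceil-half≤1+floor-half (suc (suc n)) = s≤s (ceil-half≤1+floor-half n)

many-SegSimple : ∀ q n → 4 + 4 * q ≤ n → AtLeast (SegSimple {n}) (2 ^ q)
many-SegSimple q n 4+4q≤n =
  from-halves ⌊ n /2⌋ ⌈ n /2⌉ (⌊n/2⌋≤⌈n/2⌉ n) (ceil-half≤1+floor-half n) 2+2q≤⌊n/2⌋
              (trans (sym (⌊n/2⌋+⌈n/2⌉≡n n)) (+-comm ⌊ n /2⌋ ⌈ n /2⌉))
  where
  2+2q≤⌊n/2⌋ : 2 + 2 * q ≤ ⌊ n /2⌋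
  2+2q≤⌊n/2⌋ = subst (_≤ ⌊ n /2⌋) (half-double (2 + 2 * q)) (⌊n/2⌋-mono (subst (_≤ n) 4+4q≡ 4+4q≤n))
    where
    open import Data.Nat.Solver using (module +-*-Solver)
    open +-*-Solver
    4+4q≡ : 4 + 4 * q ≡ (2 + 2 * q) + (2 + 2 * q)
    4+4q≡ = solve 1 (λ q → con 4 :+ con 4 :* q := (con 2 :+ con 2 :* q) :+ (con 2 :+ con 2 :* q)) refl q
  from-halves : ∀ o h → o ≤ h → h ≤ suc o → 2 + 2 * q ≤ o → n ≡ h + o → AtLeast (SegSimple {n}) (2 ^ q)
  from-halves (suc t) h o≤h h≤1+o 2+2q≤o refl =
    AtLeast-image zigzagSwaps (λ bs → criterion⇒SegSimple _ (criterion bs)) zigzagSwaps-injective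
    where open Zigzag.Family h t o≤h h≤1+o q (s≤s⁻¹ 2+2q≤o)

true≢false : true ≢ false
true≢false ()

top : ∀ {m} → Fin (2 + m)
top {m} = fromℕ (suc m)

τ₀₁ : ∀ {k} → Fin (2 + k) → Fin (2 + k)
τ₀₁ = swaps (true ∷ [])

-- step true P inserts a new point 0 into the cycle just before the old 0 (shifting all
-- points up by one); step false P inserts a new fixed point 1.
step : ∀ {k} → Bool → Permutation′ (2 + k) → Permutation′ (3 + k)
step true  P = lift₀ P ∘ₚ swapsPerm (true ∷ [])
step false P = swapsPerm (true ∷ []) ∘ₚ (lift₀ P ∘ₚ swapsPerm (true ∷ []))

extend : ∀ {k} → Bool → (Fin (2 + k) → Bool) → Fin (3 + k) → Bool
extend true  S zero          = true
extend true  S (suc y)       = S y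
extend false S zero          = true
extend false S (suc zero)    = false
extend false S (suc (suc x)) = S (suc x)

-- The cycle (0 s₁ … sₖ top) through its support, traversed in increasing order.
ascendingCycle : ∀ {m} → Vec Bool m → Permutation′ (2 + m)
ascendingCycle []       = swapsPerm (true ∷ [])
ascendingCycle (b ∷ bs) = step b (ascendingCycle bs)

support : ∀ {m} → Vec Bool m → Fin (2 + m) → Bool
support []       _ = true
support (b ∷ bs)   = extend b (support bs)

record AscendingCycle {m} (π : Permutation′ (2 + m)) (S : Fin (2 + m) → Bool) : Set where
  field
    fixes-outside : ∀ x → S x ≡ false → fun π x ≡ x
    climbs        : ∀ x → S x ≡ true → x ≢ top → toℕ x < toℕ (fun π x)
    top↦zero      : fun π top ≡ zero
    top∈S         : S top ≡ true
    closed        : ∀ x → S x ≡ true → S (fun π x) ≡ true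
    zero∈S        : S zero ≡ true

ascending-base : AscendingCycle (ascendingCycle []) (support [])
ascending-base = record
  { fixes-outside = λ _ ()
  ; climbs        = λ { zero _ _ → s≤s z≤n ; (suc zero) _ 1≢top → ⊥-elim (1≢top refl) }
  ; top↦zero      = refl
  ; top∈S         = refl
  ; closed        = λ _ _ → refl
  ; zero∈S        = refl
  }

ascending-step-true : ∀ {m} (P : Permutation′ (2 + m)) S → AscendingCycle P S →
                      AscendingCycle (step true P) (extend true S)
ascending-step-true {m} P S asc = record
  { fixes-outside = fixes-outside′
  ; climbs        = climbs′
  ; top↦zero      = cong τ₀₁ (cong suc top↦zero)
  ; top∈S         = top∈S
  ; closed        = closed′
  ; zero∈S        = refl
  }
  where
  open AscendingCycle asc
  π = step true P
  fixes-outside′ : ∀ x → extend true S x ≡ false → fun π x ≡ x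
  fixes-outside′ (suc zero)    S0≡f = ⊥-elim (true≢false (trans (sym zero∈S) S0≡f))
  fixes-outside′ (suc (suc z)) e rewrite fixes-outside (suc z) e = refl
  climbs′ : ∀ x → extend true S x ≡ true → x ≢ top → toℕ x < toℕ (fun π x)
  climbs′ zero    _ _ = s≤s z≤n
  climbs′ (suc y) e y≢top with fun P y | climbs y e (λ y≡top → y≢top (cong suc y≡top))
  ... | suc z | lt = s≤s lt
  closed′ : ∀ x → extend true S x ≡ true → extend true S (fun π x) ≡ true
  closed′ zero    _ = zero∈S
  closed′ (suc y) e with fun P y | closed y e
  ... | zero  | _  = refl
  ... | suc z | e′ = e′

skip1 : ∀ {k} → Fin (2 + k) → Fin (3 + k)
skip1 y = τ₀₁ (suc y)

skip1-view : ∀ {k} (x : Fin (3 + k)) → x ≡ suc zero ⊎ Σ (Fin (2 + k)) λ y → x ≡ skip1 y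
skip1-view zero          = inj₂ (zero , refl)
skip1-view (suc zero)    = inj₁ refl
skip1-view (suc (suc z)) = inj₂ (suc z , refl)

skip1-mono : ∀ {k} (a b : Fin (2 + k)) → toℕ a < toℕ b → toℕ (skip1 a) < toℕ (skip1 b)
skip1-mono zero    (suc b) _  = s≤s z≤n
skip1-mono (suc a) (suc b) lt = s≤s lt

skip1-injective : ∀ {k} {a b : Fin (2 + k)} → skip1 a ≡ skip1 b → a ≡ b
skip1-injective {a = a} {b} e = Finₚ.suc-injective
  (trans (sym (swaps-involutive (true ∷ []) (suc a))) (trans (cong τ₀₁ e) (swaps-involutive (true ∷ []) (suc b))))

step-false-skip1 : ∀ {k} (P : Permutation′ (2 + k)) y → fun (step false P) (skip1 y) ≡ skip1 (fun P y)
step-false-skip1 P y rewrite swaps-involutive (true ∷ []) (suc y) = refl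

extend-false-skip1 : ∀ {k} (S : Fin (2 + k) → Bool) → S zero ≡ true → ∀ y → extend false S (skip1 y) ≡ S y
extend-false-skip1 S S0 zero    = sym S0
extend-false-skip1 S S0 (suc z) = refl

ascending-step-false : ∀ {m} (P : Permutation′ (2 + m)) S → AscendingCycle P S →
                       AscendingCycle (step false P) (extend false S)
ascending-step-false {m} P S asc = record
  { fixes-outside = fixes-outside′
  ; climbs        = climbs′
  ; top↦zero      = trans (step-false-skip1 P top) (cong skip1 top↦zero)
  ; top∈S         = top∈S
  ; closed        = closed′
  ; zero∈S        = refl
  }
  where
  open AscendingCycle asc
  π = step false P
  back : ∀ {y b} → extend false S (skip1 y) ≡ b → S y ≡ b
  back {y} e = trans (sym (extend-false-skip1 S zero∈S y)) e
  fixes-outside′ : ∀ x → extend false S x ≡ false → fun π x ≡ x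
  fixes-outside′ x e with skip1-view x
  ... | inj₁ refl       = refl
  ... | inj₂ (y , refl) = trans (step-false-skip1 P y) (cong skip1 (fixes-outside y (back e)))
  climbs′ : ∀ x → extend false S x ≡ true → x ≢ top → toℕ x < toℕ (fun π x)
  climbs′ x e x≢top with skip1-view x
  ... | inj₁ refl       = ⊥-elim (true≢false (sym e))
  ... | inj₂ (y , refl) = subst (toℕ (skip1 y) <_) (cong toℕ (sym (step-false-skip1 P y)))
                            (skip1-mono y (fun P y) (climbs y (back e) (λ y≡top → x≢top (cong skip1 y≡top))))
  closed′ : ∀ x → extend false S x ≡ true → extend false S (fun π x) ≡ true
  closed′ x e with skip1-view x
  ... | inj₁ refl       = ⊥-elim (true≢false (sym e))
  ... | inj₂ (y , refl) rewrite step-false-skip1 P y =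
    trans (extend-false-skip1 S zero∈S (fun P y)) (closed y (back e))

ascending-step : ∀ {m} b (P : Permutation′ (2 + m)) S → AscendingCycle P S → AscendingCycle (step b P) (extend b S)
ascending-step true  = ascending-step-true
ascending-step false = ascending-step-false

ascendingCycle-ascending : ∀ {m} (bs : Vec Bool m) → AscendingCycle (ascendingCycle bs) (support bs)
ascendingCycle-ascending []       = ascending-base
ascendingCycle-ascending (b ∷ bs) = ascending-step b _ _ (ascendingCycle-ascending bs)

iter-suc : ∀ {n} (f : Fin n → Fin n) k x → iter f (suc k) x ≡ iter f k (f x)
iter-suc f zero    x = refl
iter-suc f (suc k) x = cong f (iter-suc f k x)

iter-+ : ∀ {n} (f : Fin n → Fin n) a b x → iter f (a + b) x ≡ iter f a (iter f b x)
iter-+ f zero    b x = refl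
iter-+ f (suc a) b x = cong f (iter-+ f a b x)

ReachesBefore : ∀ {n} → (Fin n → Fin n) → Fin n → Fin n → Fin n → Set
ReachesBefore f z x y = Σ ℕ λ k → iter f k x ≡ y × (∀ j → j < k → iter f j x ≢ z)

record Connected {m} (π : Permutation′ (2 + m)) (S : Fin (2 + m) → Bool) : Set where
  field
    from-zero : ∀ y → S y ≡ true → ReachesBefore (fun π) top zero y
    to-top    : ∀ x → S x ≡ true → ReachesBefore (fun π) top x top

connected-base : Connected (ascendingCycle []) (support [])
connected-base = record { from-zero = from-zero ; to-top = to-top }
  where
  from-zero : ∀ (y : Fin 2) → true ≡ true → ReachesBefore (fun (ascendingCycle [])) top zero y
  from-zero zero       _ = 0 , refl , λ _ ()
  from-zero (suc zero) _ = 1 , refl , λ { zero _ () ; (suc j) (s≤s ()) }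
  to-top : ∀ (x : Fin 2) → true ≡ true → ReachesBefore (fun (ascendingCycle [])) top x top
  to-top zero       _ = 1 , refl , λ { zero _ () ; (suc j) (s≤s ()) }
  to-top (suc zero) _ = 0 , refl , λ _ ()

iter-step-false-skip1 : ∀ {k} (P : Permutation′ (2 + k)) j y →
                        iter (fun (step false P)) j (skip1 y) ≡ skip1 (iter (fun P) j y)
iter-step-false-skip1 P zero    y = refl
iter-step-false-skip1 P (suc j) y = trans (cong (fun (step false P)) (iter-step-false-skip1 P j y)) (step-false-skip1 P _)

connected-step-false : ∀ {m} (P : Permutation′ (2 + m)) S → AscendingCycle P S → Connected P S →
                       Connected (step false P) (extend false S)
connected-step-false {m} P S asc conn = record { from-zero = from-zero′ ; to-top = to-top′ }
  where
  open AscendingCycle asc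
  open Connected conn
  lift-path : ∀ {x y} → ReachesBefore (fun P) top x y → ReachesBefore (fun (step false P)) top (skip1 x) (skip1 y)
  lift-path {x} (k , reaches , avoids) =
    k , trans (iter-step-false-skip1 P k x) (cong skip1 reaches) ,
    λ j j<k visits → avoids j j<k (skip1-injective (trans (sym (iter-step-false-skip1 P j x)) visits))
  back : ∀ y → extend false S (skip1 y) ≡ true → S y ≡ true
  back y e = trans (sym (extend-false-skip1 S zero∈S y)) e
  from-zero′ : ∀ y → extend false S y ≡ true → ReachesBefore (fun (step false P)) top zero y
  from-zero′ x e with skip1-view x
  ... | inj₁ refl       = ⊥-elim (true≢false (sym e))
  ... | inj₂ (y , refl) = lift-path (from-zero y (back y e))
  to-top′ : ∀ x → extend false S x ≡ true → ReachesBefore (fun (step false P)) top x top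
  to-top′ x e with skip1-view x
  ... | inj₁ refl       = ⊥-elim (true≢false (sym e))
  ... | inj₂ (y , refl) = lift-path (to-top y (back y e))

τ₀₁-suc : ∀ {k} (w : Fin (2 + k)) → w ≢ zero → τ₀₁ (suc w) ≡ suc w
τ₀₁-suc zero    w≢0 = ⊥-elim (w≢0 refl)
τ₀₁-suc (suc w) _   = refl

connected-step-true : ∀ {m} (P : Permutation′ (2 + m)) S → AscendingCycle P S → Connected P S →
                      Connected (step true P) (extend true S)
connected-step-true {m} P S asc conn = record { from-zero = from-zero′ ; to-top = to-top′ }
  where
  open AscendingCycle asc
  open Connected conn
  π = step true P
  shifted : ∀ k z → (∀ j → j < k → iter (fun P) j z ≢ top) → ∀ j → j ≤ k →
            iter (fun π) j (suc z) ≡ suc (iter (fun P) j z)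
  shifted k z avoids zero    _   = refl
  shifted k z avoids (suc j) j<k = trans (cong (fun π) (shifted k z avoids j (<⇒≤ j<k)))
    (τ₀₁-suc (fun P (iter (fun P) j z)) (λ Pz≡0 → avoids j j<k (fun-injective P (trans Pz≡0 (sym top↦zero)))))
  lift-path : ∀ {x y} → ReachesBefore (fun P) top x y → ReachesBefore (fun π) top (suc x) (suc y)
  lift-path {x} (k , reaches , avoids) =
    k , trans (shifted k x avoids k ≤-refl) (cong suc reaches) ,
    λ j j<k visits → avoids j j<k (Finₚ.suc-injective (trans (sym (shifted k x avoids j (<⇒≤ j<k))) visits))
  prepend-zero : ∀ {y} → ReachesBefore (fun π) top (suc zero) y → ReachesBefore (fun π) top zero y
  prepend-zero (k , reaches , avoids) =
    suc k , trans (iter-suc (fun π) k zero) reaches ,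
    λ { zero _ () ; (suc j) (s≤s j<k) visits → avoids j j<k (trans (sym (iter-suc (fun π) j zero)) visits) }
  from-zero′ : ∀ y → extend true S y ≡ true → ReachesBefore (fun π) top zero y
  from-zero′ zero    _ = 0 , refl , λ _ ()
  from-zero′ (suc y) e = prepend-zero (lift-path (from-zero y e))
  to-top′ : ∀ x → extend true S x ≡ true → ReachesBefore (fun π) top x top
  to-top′ zero    _ = prepend-zero (lift-path (to-top zero zero∈S))
  to-top′ (suc y) e = lift-path (to-top y e)

connected-step : ∀ {m} b (P : Permutation′ (2 + m)) S → AscendingCycle P S → Connected P S →
                 Connected (step b P) (extend b S)
connected-step true  = connected-step-true
connected-step false = connected-step-false

ascendingCycle-connected : ∀ {m} (bs : Vec Bool m) → Connected (ascendingCycle bs) (support bs)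
ascendingCycle-connected []       = connected-base
ascendingCycle-connected (b ∷ bs) =
  connected-step b _ _ (ascendingCycle-ascending bs) (ascendingCycle-connected bs)

moved⇒in-support : ∀ {m} {π : Permutation′ (2 + m)} {S} → AscendingCycle π S → ∀ x → fun π x ≢ x → S x ≡ true
moved⇒in-support {S = S} asc x moved with S x in Sx
... | true  = refl
... | false = ⊥-elim (moved (AscendingCycle.fixes-outside asc x Sx))

in-support⇒moved : ∀ {m} {π : Permutation′ (2 + m)} {S} → AscendingCycle π S → ∀ x → S x ≡ true → fun π x ≢ x
in-support⇒moved {m} asc x Sx πx≡x with x Finₚ.≟ top
... | yes refl  = 0≢top (trans (sym (AscendingCycle.top↦zero asc)) πx≡x)
  where
  0≢top : zero ≢ top {m}
  0≢top ()
... | no  x≢top = <-irrefl (cong toℕ (sym πx≡x)) (AscendingCycle.climbs asc x Sx x≢top)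

-- Every moved point climbs to top, which is sent to 0, from which every moved point is reached.
ascendingCycle-CycleSimple : ∀ {m} (bs : Vec Bool m) → CycleSimple (ascendingCycle bs)
ascendingCycle-CycleSimple bs x y x-moved y-moved = k₂ + suc k₁ , (begin
  iter π (k₂ + suc k₁) x      ≡⟨ iter-+ π k₂ (suc k₁) x ⟩
  iter π k₂ (π (iter π k₁ x)) ≡⟨ cong (λ z → iter π k₂ (π z)) x↝top ⟩
  iter π k₂ (π top)           ≡⟨ cong (iter π k₂) top↦zero ⟩
  iter π k₂ zero              ≡⟨ zero↝y ⟩
  y                           ∎)
  where
  open ≡-Reasoning
  asc = ascendingCycle-ascending bs
  open AscendingCycle asc using (top↦zero)
  open Connected (ascendingCycle-connected bs)
  π = fun (ascendingCycle bs)
  k₁ = proj₁ (to-top x (moved⇒in-support asc x x-moved))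
  x↝top = proj₁ (proj₂ (to-top x (moved⇒in-support asc x x-moved)))
  k₂ = proj₁ (from-zero y (moved⇒in-support asc y y-moved))
  zero↝y = proj₁ (proj₂ (from-zero y (moved⇒in-support asc y y-moved)))

support-zero : ∀ {m} (bs : Vec Bool m) → support bs zero ≡ true
support-zero []          = refl
support-zero (true ∷ _)  = refl
support-zero (false ∷ _) = refl

support-injective : ∀ {m} {u v : Vec Bool m} → (∀ x → support u x ≡ support v x) → u ≡ v
support-injective {u = []}          {[]}          _ = refl
support-injective {u = true ∷ u}  {true ∷ v}  u≗v = cong (true ∷_) (support-injective (λ x → u≗v (suc x)))
support-injective {u = false ∷ u} {false ∷ v} u≗v = cong (false ∷_) (support-injective tail≗)
  where
  tail≗ : ∀ x → support u x ≡ support v x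
  tail≗ zero    = trans (support-zero u) (sym (support-zero v))
  tail≗ (suc x) = u≗v (suc (suc x))
support-injective {u = true ∷ u}  {false ∷ v} u≗v = ⊥-elim (true≢false (trans (sym (support-zero u)) (u≗v (suc zero))))
support-injective {u = false ∷ u} {true ∷ v}  u≗v = ⊥-elim (true≢false (trans (sym (support-zero v)) (sym (u≗v (suc zero)))))

ascendingCycle-injective : ∀ {m} → Injective _≡_ _≈_ (ascendingCycle {m})
ascendingCycle-injective {m} {u} {v} u≈v = support-injective same-support
  where
  asc-u = ascendingCycle-ascending u
  asc-v = ascendingCycle-ascending v
  same-support : ∀ x → support u x ≡ support v x
  same-support x with support u x in Su | support v x in Sv
  ... | true  | true  = refl
  ... | false | false = refl
  ... | true  | false = ⊥-elim (in-support⇒moved asc-u x Su (trans (u≈v x) (AscendingCycle.fixes-outside asc-v x Sv)))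
  ... | false | true  = ⊥-elim (in-support⇒moved asc-v x Sv (trans (sym (u≈v x)) (AscendingCycle.fixes-outside asc-u x Su)))

many-CycleSimple : ∀ q n → 2 + 4 * q ≤ n → AtLeast (CycleSimple {n}) (2 ^ q)
many-CycleSimple q (suc zero)    (s≤s ())
many-CycleSimple q (suc (suc m)) 2+4q≤n =
  AtLeast-mono (^-monoʳ-≤ 2 (≤-trans (m≤n*m q 4) (s≤s⁻¹ (s≤s⁻¹ 2+4q≤n))))
    (AtLeast-image ascendingCycle ascendingCycle-CycleSimple ascendingCycle-injective)

Increasing : ℕ → ℕ → List ℕ → Set
Increasing b c []       = ⊤
Increasing b c (x ∷ xs) = b ≤ x × x < c × Increasing (suc x) c xs

Increasing-weaken : ∀ {b b′ c} xs → b′ ≤ b → Increasing b c xs → Increasing b′ c xs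
Increasing-weaken []       _     _                = tt
Increasing-weaken (x ∷ xs) b′≤b (b≤x , x<c , inc) = ≤-trans b′≤b b≤x , x<c , inc

Increasing-snoc : ∀ {b c} xs → b ≤ c → Increasing b c xs → Increasing b (suc c) (xs ++ c ∷ [])
Increasing-snoc []       b≤c _                  = b≤c , ≤-refl , tt
Increasing-snoc (x ∷ xs) _   (b≤x , x<c , inc) = b≤x , m≤n⇒m≤1+n x<c , Increasing-snoc xs x<c inc

Increasing-lower : ∀ {b c} xs → Increasing b c xs → All (b ≤_) xs
Increasing-lower []       _                 = []
Increasing-lower (x ∷ xs) (b≤x , _ , inc) =
  b≤x ∷ All.map (λ 1+x≤y → ≤-trans b≤x (≤-trans (n≤1+n x) 1+x≤y)) (Increasing-lower xs inc)

foldr-⊓-lower : ∀ x xs → All (x ≤_) xs → foldr _⊓_ x xs ≡ x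
foldr-⊓-lower x []       _           = refl
foldr-⊓-lower x (y ∷ ys) (x≤y ∷ x≤ys) rewrite foldr-⊓-lower x ys x≤ys = m≥n⇒m⊓n≡n x≤y

foldr-⊓-≤ : ∀ x ys z zs → foldr _⊓_ x (ys ++ z ∷ zs) ≤ z
foldr-⊓-≤ x []       z zs = m⊓n≤m z _
foldr-⊓-≤ x (y ∷ ys) z zs = ≤-trans (m⊓n≤n y _) (foldr-⊓-≤ x ys z zs)

≡ᵇ-refl : ∀ x → (x ≡ᵇ x) ≡ true
≡ᵇ-refl zero    = refl
≡ᵇ-refl (suc x) = ≡ᵇ-refl x

buildT-[] : ∀ f → buildT f [] ≡ leaf
buildT-[] zero    = refl
buildT-[] (suc f) = refl

-- In an increasing word the smallest letter comes first, so T is a path of right children.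
Increasing⇒path : ∀ f {b c} l → Increasing b c l → length l ≤ f → AllDeg12 true (buildT f l)
Increasing⇒path zero    l        _               _   = tt
Increasing⇒path (suc f) []       _               _   = tt
Increasing⇒path (suc f) (x ∷ xs) (_ , _ , inc) len
  rewrite foldr-⊓-lower x xs (All.map <⇒≤ (Increasing-lower xs inc)) | ≡ᵇ-refl x | buildT-[] f
  = degree , tt , Increasing⇒path f xs inc (s≤s⁻¹ len)
  where
  degree : 1 ≤ 1 + nChildren (node leaf x (buildT f xs)) × 1 + nChildren (node leaf x (buildT f xs)) ≤ 2
  degree with buildT f xs
  ... | leaf       = s≤s z≤n , s≤s z≤n
  ... | node _ _ _ = s≤s z≤n , s≤s (s≤s z≤n)

break-at-0 : ∀ u v → All (1 ≤_) u → break (λ y → y ≟ 0) (u ++ 0 ∷ v) ≡ (u , 0 ∷ v)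
break-at-0 []          v _              = refl
break-at-0 (suc y ∷ u) v (s≤s _ ∷ 1≤u) rewrite break-at-0 u v 1≤u = refl

-- With 0 between two increasing words of positive letters, T has root 0 and two paths
-- below it; the left one is non-empty.
two-paths⇒AllDeg12 : ∀ x xs v {c d} → Increasing 1 c (x ∷ xs) → Increasing 1 d v → AllDeg12 false (T ((x ∷ xs) ++ 0 ∷ v))
two-paths⇒AllDeg12 x xs v inc-u inc-v
  rewrite n≤0⇒n≡0 (foldr-⊓-≤ x xs 0 v) | break-at-0 (x ∷ xs) v (Increasing-lower (x ∷ xs) inc-u)
  = degree , Increasing⇒path f (x ∷ xs) inc-u len-u , Increasing⇒path f v inc-v len-v
  where
  f = length (xs ++ 0 ∷ v)
  f≡ : f ≡ length xs + suc (length v)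
  f≡ = length-++ xs
  len-u : suc (length xs) ≤ f
  len-u = subst (suc (length xs) ≤_) (sym (trans f≡ (+-suc (length xs) (length v)))) (m≤m+n (suc (length xs)) (length v))
  len-v : length v ≤ f
  len-v = subst (length v ≤_) (sym f≡) (≤-trans (n≤1+n _) (m≤n+m (suc (length v)) (length xs)))
  degree : 1 ≤ nChildren (node (buildT f (x ∷ xs)) 0 (buildT f v)) × nChildren (node (buildT f (x ∷ xs)) 0 (buildT f v)) ≤ 2
  degree with f | len-u
  ... | suc f′ | _ with buildT (suc f′) v
  ...   | leaf       = s≤s z≤n , s≤s z≤n
  ...   | node _ _ _ = s≤s z≤n , s≤s (s≤s z≤n)

foldr-∧-true : ∀ (p : ℕ → Bool) → (∀ k → p k ≡ true) → ∀ ks → foldr (λ k acc → p k ∧ acc) true ks ≡ true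
foldr-∧-true p p≡true []       = refl
foldr-∧-true p p≡true (k ∷ ks) rewrite p≡true k = foldr-∧-true p p≡true ks

tabulate-increasing : ∀ {n} k (g : Fin k → Fin n) b → (∀ i → toℕ (g i) ≡ b + toℕ i) → b + k ≤ n →
                      Increasing b n (map toℕ (tabulate g))
tabulate-increasing zero    g b g≡ b+k≤n = tt
tabulate-increasing {n} (suc k) g b g≡ b+k≤n =
    ≤-reflexive (sym g0≡b)
  , subst (_< n) (sym g0≡b) (<-≤-trans (subst (_< b + suc k) (+-identityʳ b) (+-monoʳ-< b (s≤s z≤n))) b+k≤n)
  , subst (λ z → Increasing (suc z) n (map toℕ (tabulate (λ i → g (suc i))))) (sym g0≡b)
      (tabulate-increasing k (λ i → g (suc i)) (suc b) (λ i → trans (g≡ (suc i)) (+-suc b (toℕ i)))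
        (subst (_≤ n) (+-suc b k) b+k≤n))
  where
  g0≡b : toℕ (g zero) ≡ b
  g0≡b = trans (g≡ zero) (+-identityʳ b)

-- For an ascending cycle, the word of T is  A ++ [top] ++ 0 ∷ C  where A lists the fixed
-- points and C the rest of the cycle, both increasing.
module CycleWordOf {m} (π : Permutation′ (2 + m)) (S : Fin (2 + m) → Bool) (asc : AscendingCycle π S) where

  open AscendingCycle asc

  f : Fin (2 + m) → Fin (2 + m)
  f = fun π

  toℕ-top : toℕ (top {m}) ≡ suc m
  toℕ-top = Finₚ.toℕ-fromℕ (suc m)

  ≤top : ∀ (y : Fin (2 + m)) → toℕ y ≤ toℕ (top {m})
  ≤top y = subst (toℕ y ≤_) (sym toℕ-top) (s≤s⁻¹ (Finₚ.toℕ<n y))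

  top≢0 : top {m} ≢ zero
  top≢0 ()

  iter-fixed : ∀ x → S x ≡ false → ∀ k → iter f k x ≡ x
  iter-fixed x x∉S zero                                    = refl
  iter-fixed x x∉S (suc k) rewrite iter-fixed x x∉S k = fixes-outside x x∉S

  fixed-isCycleMax : ∀ x → S x ≡ false → isCycleMax π x ≡ true
  fixed-isCycleMax x x∉S = foldr-∧-true _
    (λ k → dec-true (toℕ (iter f k x) ≤? toℕ x) (≤-reflexive (cong toℕ (iter-fixed x x∉S k)))) (upTo (2 + m))

  top-isCycleMax : isCycleMax π top ≡ true
  top-isCycleMax = foldr-∧-true _ (λ k → dec-true (toℕ (iter f k top) ≤? toℕ top) (≤top _)) (upTo (2 + m))

  climbing-not-isCycleMax : ∀ x → S x ≡ true → x ≢ top → isCycleMax π x ≡ false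
  climbing-not-isCycleMax x x∈S x≢top
    rewrite dec-true (toℕ x ≤? toℕ x) ≤-refl | dec-false (toℕ (f x) ≤? toℕ x) (<⇒≱ (climbs x x∈S x≢top)) = refl

  ≢? : ∀ (x y : Fin (2 + m)) → Dec (y ≢ x)
  ≢? x y = ¬? (y Finₚ.≟ x)

  takeWhile-stop : ∀ x y ys → y ≡ x → takeWhile (≢? x) (y ∷ ys) ≡ []
  takeWhile-stop x y ys y≡x with y Finₚ.≟ x
  ... | yes _   = refl
  ... | no  y≢x = ⊥-elim (y≢x y≡x)

  takeWhile-go : ∀ x y ys → y ≢ x → takeWhile (≢? x) (y ∷ ys) ≡ y ∷ takeWhile (≢? x) ys
  takeWhile-go x y ys y≢x with y Finₚ.≟ x
  ... | yes y≡x = ⊥-elim (y≢x y≡x)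
  ... | no  _   = refl

  cycleFrom-fixed : ∀ x → S x ≡ false → cycleFrom π x ≡ x ∷ []
  cycleFrom-fixed x x∉S = cong (x ∷_) (stops (upTo (1 + m)))
    where
    stops : ∀ ks → takeWhile (≢? x) (map (λ k → iter f (suc k) x) ks) ≡ []
    stops []       = refl
    stops (k ∷ ks) = takeWhile-stop x _ _ (iter-fixed x x∉S (suc k))

  data Orbit (y : Fin (2 + m)) : List (Fin (2 + m)) → Set where
    done : Orbit y []
    next : ∀ {l} → Orbit (f y) l → Orbit y (f y ∷ l)

  applyUpTo-orbit : ∀ k (F : ℕ → Fin (2 + m)) y → F 0 ≡ f y → (∀ i → F (suc i) ≡ f (F i)) → Orbit y (applyUpTo F k)
  applyUpTo-orbit zero    F y _     _     = done
  applyUpTo-orbit (suc k) F y F0≡fy F-step =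
    subst (λ z → Orbit y (z ∷ applyUpTo (λ i → F (suc i)) k)) (sym F0≡fy)
      (next (subst (λ z → Orbit z (applyUpTo (λ i → F (suc i)) k)) F0≡fy
        (applyUpTo-orbit k (λ i → F (suc i)) (F 0) (F-step 0) (λ i → F-step (suc i)))))

  laterIterates-orbit : Orbit top (laterIterates π top)
  laterIterates-orbit = subst (Orbit top) (sym (map-applyUpTo (λ k → k) (λ k → iter f (suc k) top) (suc m)))
    (applyUpTo-orbit (suc m) (λ k → iter f (suc k) top) top refl (λ _ → refl))

  orbit-increasing : ∀ y l → Orbit y l → S y ≡ true → y ≢ top →
                     Increasing (suc (toℕ y)) (toℕ (top {m})) (map toℕ (takeWhile (≢? top) l))
  orbit-increasing y []          done     _   _     = tt
  orbit-increasing y (.(f y) ∷ l) (next o) y∈S y≢top with f y Finₚ.≟ top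
  ... | yes _     = tt
  ... | no fy≢top = climbs y y∈S y≢top , ≤∧≢⇒< (≤top (f y)) (λ eq → fy≢top (Finₚ.toℕ-injective eq))
                  , orbit-increasing (f y) l o (closed y y∈S) fy≢top

  rest-of-top-cycle : ∀ (l : List (Fin (2 + m))) → Orbit top l → l ≡ laterIterates π top →
                      Σ (List (Fin (2 + m))) λ C → takeWhile (≢? top) l ≡ zero ∷ C × Increasing 1 (toℕ (top {m})) (map toℕ C)
  rest-of-top-cycle []            done     ()
  rest-of-top-cycle (.(f top) ∷ l) (next o) _ =
      takeWhile (≢? top) l
    , trans (takeWhile-go top (f top) l ftop≢top) (cong (_∷ takeWhile (≢? top) l) top↦zero)
    , subst (λ z → Increasing (suc z) (toℕ (top {m})) (map toℕ (takeWhile (≢? top) l))) (cong toℕ top↦zero)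
            (orbit-increasing (f top) l o (closed top top∈S) ftop≢top)
    where
    ftop≢top : f top ≢ top
    ftop≢top eq = top≢0 (trans (sym eq) top↦zero)

  cycleFrom-top : Σ (List (Fin (2 + m))) λ C → cycleFrom π top ≡ top {m} ∷ zero ∷ C × Increasing 1 (toℕ (top {m})) (map toℕ C)
  cycleFrom-top with rest-of-top-cycle (laterIterates π top) laterIterates-orbit refl
  ... | C , C≡ , inc = C , cong (top ∷_) C≡ , inc

  block : Fin (2 + m) → List (Fin (2 + m))
  block y = if isCycleMax π y then cycleFrom π y else []

  block-fixed : ∀ x → S x ≡ false → block x ≡ x ∷ []
  block-fixed x x∉S = trans (cong (λ b → if b then cycleFrom π x else []) (fixed-isCycleMax x x∉S)) (cycleFrom-fixed x x∉S)

  block-climbing : ∀ x → S x ≡ true → x ≢ top → block x ≡ []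
  block-climbing x x∈S x≢top = cong (λ b → if b then cycleFrom π x else []) (climbing-not-isCycleMax x x∈S x≢top)

  block-top : block top ≡ cycleFrom π top
  block-top = cong (λ b → if b then cycleFrom π top else []) top-isCycleMax

  fixed⇒positive : ∀ x → S x ≡ false → 1 ≤ toℕ x
  fixed⇒positive zero    x∉S = ⊥-elim (true≢false (trans (sym zero∈S) x∉S))
  fixed⇒positive (suc _) _   = s≤s z≤n

  -- Scanning the points in increasing order: fixed points contribute themselves, other
  -- points of the cycle nothing, until top contributes its whole cycle.
  blocks-split : ∀ xs b → Increasing b (suc (toℕ (top {m}))) (map toℕ xs) → top ∈ xs →
                 Σ (List ℕ) λ A → map toℕ (concatMap block xs) ≡ A ++ map toℕ (cycleFrom π top)
                                × Increasing b (toℕ (top {m})) A × All (1 ≤_) A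
  blocks-split []       b _                     ()
  blocks-split (x ∷ xs) b (b≤x , x≤top , inc) top∈ with x Finₚ.≟ top
  ... | yes refl = [] , equation , tt , []
    where
    nothing-above : ∀ {c} (ys : List (Fin (2 + m))) → Increasing (suc c) (suc c) (map toℕ ys) → ys ≡ []
    nothing-above []       _               = refl
    nothing-above (y ∷ ys) (c<y , y≤c , _) = ⊥-elim (<-irrefl refl (≤-trans y≤c c<y))
    equation : map toℕ (concatMap block (top ∷ xs)) ≡ map toℕ (cycleFrom π top)
    equation rewrite nothing-above xs inc =
      trans (cong (λ w → map toℕ (w ++ [])) block-top) (cong (map toℕ) (++-identityʳ (cycleFrom π top)))
  ... | no x≢top with blocks-split xs (suc (toℕ x)) inc (top∈tail top∈)
    where
    top∈tail : top ∈ x ∷ xs → top ∈ xs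
    top∈tail (here top≡x) = ⊥-elim (x≢top (sym top≡x))
    top∈tail (there top∈xs) = top∈xs
  ...   | A , A≡ , inc-A , 1≤A with S x in Sx
  ...     | false = toℕ x ∷ A
                  , trans (cong (λ w → map toℕ (w ++ concatMap block xs)) (block-fixed x Sx)) (cong (toℕ x ∷_) A≡)
                  , (b≤x , ≤∧≢⇒< (s≤s⁻¹ x≤top) (λ eq → x≢top (Finₚ.toℕ-injective eq)) , inc-A)
                  , fixed⇒positive x Sx ∷ 1≤A
  ...     | true  = A , trans (cong (λ w → map toℕ (w ++ concatMap block xs)) (block-climbing x Sx x≢top)) A≡
                  , Increasing-weaken A (≤-trans b≤x (n≤1+n _)) inc-A , 1≤A

  cycleWord-shape : Σ (List ℕ) λ A → Σ (List (Fin (2 + m))) λ C →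
                    cycleWord π ≡ (A ++ toℕ (top {m}) ∷ []) ++ 0 ∷ map toℕ C
                    × Increasing 1 (suc (toℕ (top {m}))) (A ++ toℕ (top {m}) ∷ []) × Increasing 1 (toℕ (top {m})) (map toℕ C)
  cycleWord-shape with blocks-split (allFin (2 + m)) 0 all-increasing (∈-allFin top) | cycleFrom-top
    where
    all-increasing : Increasing 0 (suc (toℕ (top {m}))) (map toℕ (allFin (2 + m)))
    all-increasing = subst (λ z → Increasing 0 z (map toℕ (allFin (2 + m)))) (cong suc (sym toℕ-top))
                       (tabulate-increasing (2 + m) (λ i → i) 0 (λ _ → refl) ≤-refl)
  ... | A , A≡ , inc-A , 1≤A | C , C≡ , inc-C =
    A , C , word≡ , Increasing-snoc A (subst (1 ≤_) (sym toℕ-top) (s≤s z≤n)) (positive A inc-A 1≤A) , inc-C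
    where
    positive : ∀ {c} A → Increasing 0 c A → All (1 ≤_) A → Increasing 1 c A
    positive []      _               _         = tt
    positive (a ∷ A) (_ , a<c , inc) (1≤a ∷ _) = 1≤a , a<c , inc
    word≡ : cycleWord π ≡ (A ++ toℕ top ∷ []) ++ 0 ∷ map toℕ C
    word≡ = begin
      cycleWord π                                ≡⟨ A≡ ⟩
      A ++ map toℕ (cycleFrom π top)             ≡⟨ cong (λ w → A ++ map toℕ w) C≡ ⟩
      A ++ toℕ top ∷ 0 ∷ map toℕ C               ≡⟨ sym (++-assoc A (toℕ top ∷ []) (0 ∷ map toℕ C)) ⟩
      (A ++ toℕ top ∷ []) ++ 0 ∷ map toℕ C       ∎
      where open ≡-Reasoning

AscendingCycle⇒TreeSimple : ∀ {m} {π : Permutation′ (2 + m)} {S} → AscendingCycle π S → TreeSimple π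
AscendingCycle⇒TreeSimple {m} {π} {S} asc with CycleWordOf.cycleWord-shape π S asc
... | A , C , word≡ , inc-A , inc-C = inj₂ (subst (λ w → AllDeg12 false (T w)) (sym word≡) (nonempty A inc-A))
  where
  nonempty : ∀ A → Increasing 1 (suc (toℕ (top {m}))) (A ++ toℕ (top {m}) ∷ []) →
             AllDeg12 false (T ((A ++ toℕ (top {m}) ∷ []) ++ 0 ∷ map toℕ C))
  nonempty []      inc = two-paths⇒AllDeg12 _ [] (map toℕ C) inc inc-C
  nonempty (a ∷ A) inc = two-paths⇒AllDeg12 a (A ++ toℕ top ∷ []) (map toℕ C) inc inc-C

many-TreeSimple : ∀ q n → 2 + 4 * q ≤ n → AtLeast (TreeSimple {n}) (2 ^ q)
many-TreeSimple q (suc zero)    (s≤s ())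
many-TreeSimple q (suc (suc m)) 2+4q≤n =
  AtLeast-mono (^-monoʳ-≤ 2 (≤-trans (m≤n*m q 4) (s≤s⁻¹ (s≤s⁻¹ 2+4q≤n))))
    (AtLeast-image ascendingCycle (λ bs → AscendingCycle⇒TreeSimple (ascendingCycle-ascending bs))
                   ascendingCycle-injective)

theorem1p8 : ExpGrowth (λ n π → SegSimple {n} π)
           × ExpGrowth (λ n π → CycleSimple {n} π)
           × ExpGrowth (λ n π → GroupSimple {n} π)
           × ExpGrowth (λ n π → BraidSimple {n} π)
           × ExpGrowth (λ n π → TreeSimple {n} π)
theorem1p8 = expGrowth-from-bits _ 4 many-SegSimple
           , expGrowth-from-bits _ 2 many-CycleSimple
           , expGrowth-from-bits _ 0 many-GroupSimple
           , expGrowth-from-bits _ 0 many-BraidSimple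
           , expGrowth-from-bits _ 2 many-TreeSimple
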